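{- Let $q$ be a prime power and let $G,H$ be finite groups with $|G|=q^n$ and $|H|=q$. Then there is a chain of subgroups $\mathcal{C}:\ \{e\}=H_0\subsetneq H_1\subsetneq\dots\subsetneq H_n=G$ with $[H_i:H_{i-1}]=q$ for $i=1,\dots,n$ such that $(G,d_{\mathcal{C}})$ is isometric to $(H^n,d_{RT})$.
   Context: The chain metric of $\mathcal{C}$ is $d_{\mathcal{C}}(x,y)=i$ if $xy^{ -1}\in H_i\setminus H_{i-1}$, $i=0,\dots,n$, with $H_{ -1}=\varnothing$. The Rosenbloom–Tsfasman metric on $H^n$ is $d_{RT}(x,y)=\max\{1\le i\le n: x_i\ne y_i\}$ for $x\ne y$ and $d_{RT}(x,x)=0$. An isometry is a distance-preserving bijection. -}

module Defs where

open import Level using (Level; _⊔_) renaming (suc to lsuc)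
open import Algebra.Bundles using (Group)
open import Data.Nat using (ℕ; zero; suc; _≤_; _<_; _^_; _*_)
open import Data.Nat.Primality using (Prime)
open import Data.Fin using (Fin; toℕ; inject₁; fromℕ) renaming (zero to fzero; suc to fsuc)
open import Data.Product using (Σ; ∃; ∃₂; _×_; _,_; proj₁)
open import Data.Sum using (_⊎_)
open import Data.Unit.Polymorphic using (⊤)
open import Relation.Nullary using (¬_)
open import Relation.Unary using (Pred)
open import Relation.Binary.Bundles using (Setoid)
open import Relation.Binary.PropositionalEquality as ≡ using (_≡_)
import Relation.Binary.Construct.On as On
open import Function.Bundles using (Inverse; _⇔_)

IsPrimePower : ℕ → Set
IsPrimePower q = ∃₂ λ p k → Prime p × 1 ≤ k × q ≡ p ^ k

HasCard : ∀ {c ℓ} → Setoid c ℓ → ℕ → Set (c ⊔ ℓ)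
HasCard S m = Inverse S (≡.setoid (Fin m))

record Subgroup {c ℓ} (G : Group c ℓ) : Set (lsuc (c ⊔ ℓ)) where
  open Group G
  field
    mem  : Pred Carrier (c ⊔ ℓ)
    resp : ∀ {x y} → x ≈ y → mem x → mem y
    ε∈   : mem ε
    ∙∈   : ∀ {x y} → mem x → mem y → mem (x ∙ y)
    ⁻¹∈  : ∀ {x} → mem x → mem (x ⁻¹)

module _ {c ℓ} {G : Group c ℓ} where
  open Group G

  subSetoid : Subgroup G → Setoid (c ⊔ ℓ) ℓ
  subSetoid K = On.setoid setoid (proj₁ {B = Subgroup.mem K})

  _⊆_ : Subgroup G → Subgroup G → Set (c ⊔ ℓ)
  K ⊆ L = ∀ {x} → Subgroup.mem K x → Subgroup.mem L x

  -- [L : K] = q  (for finite groups: |L| = q · |K|)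
  IndexIs : Subgroup G → Subgroup G → ℕ → Set (c ⊔ ℓ)
  IndexIs L K q = ∃ λ a → HasCard (subSetoid K) a × HasCard (subSetoid L) (q * a)

record Chain {c ℓ} (G : Group c ℓ) (n q : ℕ) : Set (lsuc (c ⊔ ℓ)) where
  open Group G
  field
    H       : Fin (suc n) → Subgroup G
    bottom  : ∀ x → Subgroup.mem (H fzero) x ⇔ (x ≈ ε)
    top     : ∀ x → Subgroup.mem (H (fromℕ n)) x
    incl    : ∀ (i : Fin n) → H (inject₁ i) ⊆ H (fsuc i)
    strict  : ∀ (i : Fin n) → ¬ (H (fsuc i) ⊆ H (inject₁ i))
    index   : ∀ (i : Fin n) → IndexIs (H (fsuc i)) (H (inject₁ i)) q

  -- "z ∉ H_{i-1}", with H_{-1} = ∅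
  NotBelow : Fin (suc n) → Carrier → Set (c ⊔ ℓ)
  NotBelow fzero    z = ⊤
  NotBelow (fsuc j) z = ¬ Subgroup.mem (H (inject₁ j)) z

  DistC : Carrier → Carrier → ℕ → Set (c ⊔ ℓ)
  DistC x y d = ∃ λ (i : Fin (suc n)) →
    toℕ i ≡ d × Subgroup.mem (H i) (x ∙ y ⁻¹) × NotBelow i (x ∙ y ⁻¹)

-- H^n, coordinates x_1..x_n stored as Fin n → Carrier (index k ↦ position k+1)
module _ {c ℓ} (H : Group c ℓ) (n : ℕ) where
  open Group H

  Hⁿ : Setoid c ℓ
  Hⁿ = record
    { Carrier = Fin n → Carrier
    ; _≈_ = λ u v → ∀ k → u k ≈ v k
    ; isEquivalence = record
      { refl = λ k → refl ; sym = λ p k → sym (p k) ; trans = λ p r k → trans (p k) (r k) } }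

  DistRT : (Fin n → Carrier) → (Fin n → Carrier) → ℕ → Set ℓ
  DistRT u v d =
    (d ≡ 0 × (∀ k → u k ≈ v k)) ⊎
    (∃ λ (k : Fin n) → d ≡ suc (toℕ k) × ¬ (u k ≈ v k) ×
                       (∀ (j : Fin n) → toℕ k < toℕ j → u j ≈ v j))

Isometric : ∀ {c₁ ℓ₁ c₂ ℓ₂} {G : Group c₁ ℓ₁} {n q : ℕ} → Chain G n q → (H : Group c₂ ℓ₂) →
            Set (c₁ ⊔ ℓ₁ ⊔ c₂ ⊔ ℓ₂)
Isometric {G = G} {n = n} C H =
  Σ (Inverse (Group.setoid G) (Hⁿ H n)) λ f →
    ∀ x y d → Chain.DistC C x y d ⇔ DistRT H n (Inverse.to f x) (Inverse.to f y) d

-- Write q = p^k. A group of order p^m has subgroups {e} = K_0 ⊂ K_1 ⊂ … ⊂ K_m with |K_j| = p^j: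
-- if |K| = p^j < p^m, a counting argument mod p gives g ∉ K normalising K, a suitable power h of g
-- has h ∉ K and h^p ∈ K, and then K⟨h⟩ = K ∪ Kh ∪ … ∪ Kh^(p-1) has order p|K|. Keeping every k-th
-- member gives the chain H_0 ⊂ … ⊂ H_n with [H_i : H_{i-1}] = q. Numbering the q cosets of H_{i-1}
-- inside H_i by the elements of H attaches to x ∈ G digits x_1, …, x_n, and x y⁻¹ ∈ H_i exactly
-- when x and y have the same digits at all positions above i; this is d_C = d_RT.

module Submission where

module Counting where

  open import Data.Bool using (Bool; true; false; T; _∧_; not; if_then_else_)
  open import Data.Bool.Properties using (T-irrelevant)
  open import Data.Empty using (⊥-elim)
  open import Data.Fin using (Fin; toℕ) renaming (zero to fz; suc to fs)
  open import Data.Fin.Properties using (_≟_; any?; toℕ-injective; injective⇒≤; suc-injective)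
  open import Data.Nat using (ℕ; zero; suc; _+_; _*_; _≤_; _<_; z≤n; s≤s)
  open import Data.Nat.Properties
    using (+-comm; +-suc; +-mono-≤; +-cancelˡ-≤; ≤-refl; ≤-trans; ≤-reflexive; ≤-antisym; <-irrefl;
           m≤n⇒m≤1+n; +-identityʳ; *-zeroʳ; *-distribʳ-+; module ≤-Reasoning)
  open import Data.Product using (∃; _×_; _,_)
  open import Function using (_∘_)
  open import Relation.Nullary using (¬_; yes; no)
  open import Relation.Nullary.Decidable using (⌊_⌋; T?; toWitness; fromWitness; toWitnessFalse; fromWitnessFalse)
  open import Relation.Binary.PropositionalEquality
  import Data.Nat.Solver

  private
    variable
      N M : ℕ

  ∧-intro : ∀ {a b} → T a → T b → T (a ∧ b)
  ∧-intro {true} {true} _ _ = _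

  ∧-proj₁ : ∀ {a b} → T (a ∧ b) → T a
  ∧-proj₁ {true} _ = _

  ∧-proj₂ : ∀ {a b} → T (a ∧ b) → T b
  ∧-proj₂ {true} t = t

  T-ext : ∀ {a b} → (T a → T b) → (T b → T a) → a ≡ b
  T-ext {true} {true} _ _ = refl
  T-ext {true} {false} f _ = ⊥-elim (f _)
  T-ext {false} {true} _ g = ⊥-elim (g _)
  T-ext {false} {false} _ _ = refl

  T⇒≡true : ∀ {b} → T b → b ≡ true
  T⇒≡true {true} _ = refl

  ¬T⇒≡false : ∀ {b} → ¬ T b → b ≡ false
  ¬T⇒≡false {true} ¬t = ⊥-elim (¬t _)
  ¬T⇒≡false {false} _ = refl

  _==_ : Fin N → Fin N → Bool
  x == y = ⌊ x ≟ y ⌋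

  ==⇒≡ : {x y : Fin N} → T (x == y) → x ≡ y
  ==⇒≡ = toWitness

  ≡⇒== : {x y : Fin N} → x ≡ y → T (x == y)
  ≡⇒== = fromWitness

  ==-refl : (x : Fin N) → T (x == x)
  ==-refl x = ≡⇒== refl

  ≢⇒not== : {x y : Fin N} → x ≢ y → T (not (x == y))
  ≢⇒not== = fromWitnessFalse

  not==⇒≢ : {x y : Fin N} → T (not (x == y)) → x ≢ y
  not==⇒≢ = toWitnessFalse

  opaque
    Any : (Fin N → Bool) → Bool
    Any P = ⌊ any? (T? ∘ P) ⌋

    Any-intro : (P : Fin N → Bool) (x : Fin N) → T (P x) → T (Any P)
    Any-intro P x p = fromWitness (x , p)

    Any-elim : (P : Fin N → Bool) → T (Any P) → ∃ λ x → T (P x)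
    Any-elim P = toWitness

  indicator : Bool → ℕ
  indicator true = 1
  indicator false = 0

  count : (Fin N → Bool) → ℕ
  count {zero} P = 0
  count {suc N} P = indicator (P fz) + count (P ∘ fs)

  ∑ : (Fin M → ℕ) → ℕ
  ∑ {zero} h = 0
  ∑ {suc M} h = h fz + ∑ (h ∘ fs)

  count-cong : {P Q : Fin N → Bool} → (∀ x → P x ≡ Q x) → count P ≡ count Q
  count-cong {zero} e = refl
  count-cong {suc N} e = cong₂ _+_ (cong indicator (e fz)) (count-cong (e ∘ fs))

  count-mono : {P Q : Fin N → Bool} → (∀ x → T (P x) → T (Q x)) → count P ≤ count Q
  count-mono {zero} f = z≤n
  count-mono {suc N} f = +-mono-≤ (indicator-mono (f fz)) (count-mono (f ∘ fs))
    where
    indicator-mono : ∀ {a b} → (T a → T b) → indicator a ≤ indicator b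
    indicator-mono {false} _ = z≤n
    indicator-mono {true} {true} _ = ≤-refl
    indicator-mono {true} {false} g = ⊥-elim (g _)

  count≤size : (P : Fin N → Bool) → count P ≤ N
  count≤size {zero} P = z≤n
  count≤size {suc N} P with P fz
  ... | true = s≤s (count≤size (P ∘ fs))
  ... | false = m≤n⇒m≤1+n (count≤size (P ∘ fs))

  count≡size⇒all : (P : Fin N → Bool) → count P ≡ N → ∀ x → T (P x)
  count≡size⇒all {suc N} P eq x with P fz in e
  count≡size⇒all {suc N} P eq fz | true rewrite e = _
  count≡size⇒all {suc N} P eq (fs x) | true = count≡size⇒all (P ∘ fs) (cong Data.Nat.pred eq) x
  count≡size⇒all {suc N} P eq x | false =
    ⊥-elim (<-irrefl refl (subst (_≤ N) eq (count≤size (P ∘ fs))))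

  count-const-true : ∀ N → count {N} (λ _ → true) ≡ N
  count-const-true zero = refl
  count-const-true (suc N) = cong suc (count-const-true N)

  count-empty : {P : Fin N → Bool} → (∀ x → ¬ T (P x)) → count P ≡ 0
  count-empty {zero} _ = refl
  count-empty {suc N} {P} none with P fz in e
  ... | true = ⊥-elim (none fz (subst T (sym e) _))
  ... | false = count-empty (none ∘ fs)

  count-positive : (P : Fin N → Bool) → 0 < count P → ∃ λ x → T (P x)
  count-positive {suc N} P pos with P fz in e
  ... | true = fz , subst T (sym e) _
  ... | false with count-positive (P ∘ fs) pos
  ... | x , px = fs x , px

  count-singleton : (a : Fin N) → count (_== a) ≡ 1
  count-singleton {suc N} fz = cong suc (count-empty {N} {P = λ x → fs x == fz} λ x t → fs≢fz {x} (==⇒≡ t))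
    where
    fs≢fz : {x : Fin N} → fs x ≢ fz
    fs≢fz ()
  count-singleton {suc N} (fs a) =
    trans (count-cong {P = λ x → fs x == fs a} {Q = _== a}
                      λ x → T-ext (≡⇒== ∘ suc-injective ∘ ==⇒≡) (≡⇒== ∘ cong fs ∘ ==⇒≡))
          (count-singleton a)

  count-witness : (P : Fin N → Bool) (x : Fin N) → T (P x) → 1 ≤ count P
  count-witness P x px = ≤-trans (≤-reflexive (sym (count-singleton x)))
                                 (count-mono {P = _== x} {Q = P} λ y y=x → subst (T ∘ P) (sym (==⇒≡ y=x)) px)

  count-split : (P Q : Fin N → Bool) →
                count P ≡ count (λ x → P x ∧ Q x) + count (λ x → P x ∧ not (Q x))
  count-split {zero} P Q = refl
  count-split {suc N} P Q with P fz | Q fz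
  ... | true | true = cong suc (count-split (P ∘ fs) (Q ∘ fs))
  ... | true | false = trans (cong suc (count-split (P ∘ fs) (Q ∘ fs))) (sym (+-suc _ _))
  ... | false | _ = count-split (P ∘ fs) (Q ∘ fs)

  private
    count-at : (P : Fin N → Bool) (a : Fin N) → T (P a) → count (λ x → P x ∧ (x == a)) ≡ 1
    count-at P a pa = trans (count-cong {P = λ x → P x ∧ (x == a)} {Q = _== a} λ x → T-ext ∧-proj₂ λ x=a →
                              ∧-intro (subst (T ∘ P) (sym (==⇒≡ x=a)) pa) x=a)
                            (count-singleton a)

  count≡1⇒unique : (P : Fin N → Bool) (a : Fin N) → T (P a) → count P ≡ 1 →
                   ∀ b → T (P b) → b ≡ a
  count≡1⇒unique P a pa c1 b pb with b ≟ a
  ... | yes b≡a = b≡a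
  ... | no b≢a = ⊥-elim (<-irrefl refl (begin-strict
    1                                                     ≡⟨ sym (count-at P a pa) ⟩
    count (λ x → P x ∧ (x == a))                          <⟨ ≤-reflexive (sym (+-comm _ 1)) ⟩
    count (λ x → P x ∧ (x == a)) + 1                      ≤⟨ +-mono-≤ ≤-refl other ⟩
    count (λ x → P x ∧ (x == a)) + count (λ x → P x ∧ not (x == a))
                                                          ≡⟨ sym (count-split P (_== a)) ⟩
    count P                                               ≡⟨ c1 ⟩
    1                                                     ∎))
    where
    open ≤-Reasoning
    other : 1 ≤ count (λ x → P x ∧ not (x == a))
    other = count-witness _ b (∧-intro pb (≢⇒not== b≢a))

  count≥2⇒other : (P : Fin N → Bool) (a : Fin N) → 2 ≤ count P → ∃ λ b → T (P b) × b ≢ a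
  count≥2⇒other P a two with count-positive (λ x → P x ∧ not (x == a)) positive
    where
    open ≤-Reasoning
    positive : 0 < count (λ x → P x ∧ not (x == a))
    positive = +-cancelˡ-≤ 1 _ _ (begin
      2                                                        ≤⟨ two ⟩
      count P                                                  ≡⟨ count-split P (_== a) ⟩
      count (λ x → P x ∧ (x == a)) + count (λ x → P x ∧ not (x == a))
        ≤⟨ +-mono-≤ (≤-trans (count-mono {P = λ x → P x ∧ (x == a)} {Q = _== a} (λ _ → ∧-proj₂))
                             (≤-reflexive (count-singleton a)))
                    ≤-refl ⟩
      1 + count (λ x → P x ∧ not (x == a))                     ∎)
  ... | b , t = b , ∧-proj₁ t , not==⇒≢ (∧-proj₂ {P b} t)

  rank : (P : Fin N → Bool) (x : Fin N) → T (P x) → Fin (count P)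
  rank {suc N} P fz p with P fz
  ... | true = fz
  rank {suc N} P (fs x) p with P fz
  ... | true = fs (rank (P ∘ fs) x p)
  ... | false = rank (P ∘ fs) x p

  unrank : (P : Fin N → Bool) → Fin (count P) → Fin N
  unrank {suc N} P i with P fz
  unrank {suc N} P fz | true = fz
  unrank {suc N} P (fs i) | true = fs (unrank (P ∘ fs) i)
  unrank {suc N} P i | false = fs (unrank (P ∘ fs) i)

  unrank-∈ : (P : Fin N → Bool) (i : Fin (count P)) → T (P (unrank P i))
  unrank-∈ {suc N} P i with P fz in e
  unrank-∈ {suc N} P fz | true = subst T (sym e) _
  unrank-∈ {suc N} P (fs i) | true = unrank-∈ (P ∘ fs) i
  unrank-∈ {suc N} P i | false = unrank-∈ (P ∘ fs) i

  unrank-rank : (P : Fin N → Bool) (x : Fin N) (p : T (P x)) → unrank P (rank P x p) ≡ x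
  unrank-rank {suc N} P fz p with P fz
  ... | true = refl
  unrank-rank {suc N} P (fs x) p with P fz
  ... | true = cong fs (unrank-rank (P ∘ fs) x p)
  ... | false = cong fs (unrank-rank (P ∘ fs) x p)

  unrank-injective : (P : Fin N → Bool) {i j : Fin (count P)} → unrank P i ≡ unrank P j → i ≡ j
  unrank-injective {suc N} P {i} {j} eq with P fz
  unrank-injective {suc N} P {fz} {fz} eq | true = refl
  unrank-injective {suc N} P {fs i} {fs j} eq | true = cong fs (unrank-injective (P ∘ fs) (suc-injective eq))
  unrank-injective {suc N} P {i} {j} eq | false = unrank-injective (P ∘ fs) (suc-injective eq)

  rank-unrank : (P : Fin N → Bool) (i : Fin (count P)) (p : T (P (unrank P i))) → rank P (unrank P i) p ≡ i
  rank-unrank P i p = unrank-injective P (unrank-rank P (unrank P i) p)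

  rank-cong : (P : Fin N → Bool) {x y : Fin N} {p : T (P x)} {q : T (P y)} → x ≡ y → rank P x p ≡ rank P y q
  rank-cong P {p = p} {q} refl = cong (rank P _) (T-irrelevant p q)

  rank-injective : (P : Fin N → Bool) {x y : Fin N} {p : T (P x)} {q : T (P y)} → rank P x p ≡ rank P y q → x ≡ y
  rank-injective P {x} {y} {p} {q} eq =
    trans (sym (unrank-rank P x p)) (trans (cong (unrank P) eq) (unrank-rank P y q))

  count-≤-injection : {P : Fin N → Bool} {Q : Fin M → Bool}
                      (f : ∀ x → T (P x) → Fin M) → (∀ x p → T (Q (f x p))) →
                      (∀ x y p q → f x p ≡ f y q → x ≡ y) → count P ≤ count Q
  count-≤-injection {P = P} {Q} f f-∈ f-inj = injective⇒≤ {f = F} F-injective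
    where
    F : Fin (count P) → Fin (count Q)
    F i = rank Q (f (unrank P i) (unrank-∈ P i)) (f-∈ _ _)
    F-injective : ∀ {i j} → F i ≡ F j → i ≡ j
    F-injective eq = unrank-injective P (f-inj _ _ _ _ (rank-injective Q eq))

  count-bijection : {P : Fin N → Bool} {Q : Fin M → Bool}
                    (f : Fin N → Fin M) (g : Fin M → Fin N) →
                    (∀ x → T (P x) → T (Q (f x))) → (∀ y → T (Q y) → T (P (g y))) →
                    (∀ x → T (P x) → g (f x) ≡ x) → (∀ y → T (Q y) → f (g y) ≡ y) →
                    count P ≡ count Q
  count-bijection f g f-∈ g-∈ gf fg = ≤-antisym
    (count-≤-injection (λ x _ → f x) f-∈ λ x y p q eq → trans (sym (gf x p)) (trans (cong g eq) (gf y q)))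
    (count-≤-injection (λ y _ → g y) g-∈ λ x y p q eq → trans (sym (fg x p)) (trans (cong f eq) (fg y q)))

  ∑-+ : (h k : Fin M → ℕ) → ∑ (λ y → h y + k y) ≡ ∑ h + ∑ k
  ∑-+ {zero} h k = refl
  ∑-+ {suc M} h k rewrite ∑-+ (h ∘ fs) (k ∘ fs) = +-interchange (h fz) (k fz) (∑ (h ∘ fs)) (∑ (k ∘ fs))
    where
    +-interchange : ∀ a b c d → (a + b) + (c + d) ≡ (a + c) + (b + d)
    +-interchange a b c d = solve 4 (λ a b c d → (a :+ b) :+ (c :+ d) := (a :+ c) :+ (b :+ d)) refl a b c d
      where open Data.Nat.Solver.+-*-Solver

  ∑-indicator : (Q : Fin M → Bool) → ∑ (λ y → indicator (Q y)) ≡ count Q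
  ∑-indicator {zero} Q = refl
  ∑-indicator {suc M} Q = cong (indicator (Q fz) +_) (∑-indicator (Q ∘ fs))

  ∑-zero : ∀ M → ∑ {M} (λ _ → 0) ≡ 0
  ∑-zero zero = refl
  ∑-zero (suc M) = ∑-zero M

  ∑-const-on : (Q : Fin M → Bool) (a : ℕ) (h : Fin M → ℕ) →
               (∀ y → h y ≡ (if Q y then a else 0)) → ∑ h ≡ count Q * a
  ∑-const-on {zero} Q a h e = refl
  ∑-const-on {suc M} Q a h e =
    trans (cong₂ _+_ (trans (e fz) (if-indicator (Q fz))) (∑-const-on (Q ∘ fs) a (h ∘ fs) (e ∘ fs)))
          (sym (*-distribʳ-+ a (indicator (Q fz)) (count (Q ∘ fs))))
    where
    if-indicator : ∀ b → (if b then a else 0) ≡ indicator b * a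
    if-indicator true = sym (+-identityʳ a)
    if-indicator false = refl

  count-fibres : (P : Fin N → Bool) (f : Fin N → Fin M) →
                 count P ≡ ∑ (λ y → count (λ x → P x ∧ (f x == y)))
  count-fibres {zero} {M} P f = sym (∑-zero M)
  count-fibres {suc N} {M} P f =
    trans (cong₂ _+_ head (count-fibres (P ∘ fs) (f ∘ fs)))
          (sym (∑-+ (λ y → indicator (P fz ∧ (f fz == y))) _))
    where
    head : indicator (P fz) ≡ ∑ (λ y → indicator (P fz ∧ (f fz == y)))
    head with P fz
    ... | true = sym (trans (∑-indicator (f fz ==_))
                            (trans (count-cong {Q = _== f fz} λ y → T-ext (≡⇒== ∘ sym ∘ ==⇒≡) (≡⇒== ∘ sym ∘ ==⇒≡))
                                   (count-singleton (f fz))))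
    ... | false = sym (trans (∑-indicator {M} (λ _ → false)) (count-empty {M} {P = λ _ → false} (λ _ ())))

  ∑≡count-mod : (p : ℕ) (h : Fin M → ℕ) (R : Fin M → Bool) →
                (∀ y → ∃ λ w → h y ≡ indicator (R y) + p * w) → ∃ λ w → ∑ h ≡ count R + p * w
  ∑≡count-mod {zero} p h R f = 0 , sym (*-zeroʳ p)
  ∑≡count-mod {suc M} p h R f with f fz | ∑≡count-mod p (h ∘ fs) (R ∘ fs) (f ∘ fs)
  ... | w , e₁ | v , e₂ = w + v , (begin
    h fz + ∑ (h ∘ fs)                                        ≡⟨ cong₂ _+_ e₁ e₂ ⟩
    (indicator (R fz) + p * w) + (count (R ∘ fs) + p * v)   ≡⟨ rearrange (indicator (R fz)) (count (R ∘ fs)) p w v ⟩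
    (indicator (R fz) + count (R ∘ fs)) + p * (w + v)       ∎)
    where
    open ≡-Reasoning
    rearrange : ∀ a b p w v → (a + p * w) + (b + p * v) ≡ (a + b) + p * (w + v)
    rearrange = solve 5 (λ a b p w v → (a :+ p :* w) :+ (b :+ p :* v) := (a :+ b) :+ p :* (w :+ v)) refl
      where open Data.Nat.Solver.+-*-Solver

  private
    witness-tail : (P : Fin (suc N) → Bool) → ¬ T (P fz) → (∃ λ x → T (P x)) → ∃ λ x → T (P (fs x))
    witness-tail P ¬p0 (fz , p) = ⊥-elim (¬p0 p)
    witness-tail P ¬p0 (fs x , p) = x , p

  opaque
    least : (P : Fin N → Bool) → (∃ λ x → T (P x)) → Fin N
    least {suc N} P w with T? (P fz)
    ... | yes _ = fz
    ... | no ¬p0 = fs (least (P ∘ fs) (witness-tail P ¬p0 w))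

    least-∈ : (P : Fin N → Bool) (w : ∃ λ x → T (P x)) → T (P (least P w))
    least-∈ {suc N} P w with T? (P fz)
    ... | yes p0 = p0
    ... | no ¬p0 = least-∈ (P ∘ fs) (witness-tail P ¬p0 w)

    least-minimal : (P : Fin N → Bool) (w : ∃ λ x → T (P x)) → ∀ y → T (P y) → toℕ (least P w) ≤ toℕ y
    least-minimal {suc N} P w y py with T? (P fz)
    ... | yes _ = z≤n
    least-minimal {suc N} P w fz py | no ¬p0 = ⊥-elim (¬p0 py)
    least-minimal {suc N} P w (fs y) py | no ¬p0 = s≤s (least-minimal (P ∘ fs) (witness-tail P ¬p0 w) y py)

  least-cong : {P Q : Fin N → Bool} (v : ∃ λ x → T (P x)) (w : ∃ λ x → T (Q x)) →
               (∀ x → P x ≡ Q x) → least P v ≡ least Q w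
  least-cong {P = P} {Q} v w e = toℕ-injective (≤-antisym
    (least-minimal P v _ (subst T (sym (e _)) (least-∈ Q w)))
    (least-minimal Q w _ (subst T (e _) (least-∈ P v))))

module FiniteGroups where

  open import Algebra.Bundles using (Group)
  open import Algebra.Core using (Op₁; Op₂)
  open import Algebra.Structures using (IsGroup)
  import Algebra.Properties.Group as GroupProperties
  open import Data.Bool using (Bool; true; T; _∧_; if_then_else_)
  open import Data.Bool.Properties using (∧-identityʳ)
  open import Data.Fin using (Fin)
  open import Data.Nat using (ℕ; _*_)
  open import Data.Product using (_,_)
  open import Level using (0ℓ)
  open import Relation.Binary.PropositionalEquality
  open import Relation.Nullary using (yes; no)
  open import Relation.Nullary.Decidable using (T?)
  open Counting

  record FinGroup (N : ℕ) : Set where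
    infixl 7 _·_
    infix 8 _⁻¹
    field
      _·_     : Op₂ (Fin N)
      e       : Fin N
      _⁻¹     : Op₁ (Fin N)
      isGroup : IsGroup _≡_ _·_ e _⁻¹

    group : Group 0ℓ 0ℓ
    group = record { isGroup = isGroup }

    open IsGroup isGroup public using (assoc; identityˡ; identityʳ; inverseˡ; inverseʳ)
    open GroupProperties group public
      using (⁻¹-involutive; ⁻¹-anti-homo-∙; ε⁻¹≈ε; inverseʳ-unique; ∙-cancelˡ; ∙-cancelʳ;
             //-rightDividesˡ; //-rightDividesʳ; \\-leftDividesˡ; \\-leftDividesʳ)

    open ≡-Reasoning

    quotient-inverse : ∀ x y → (x · y ⁻¹) ⁻¹ ≡ y · x ⁻¹
    quotient-inverse x y = trans (⁻¹-anti-homo-∙ x (y ⁻¹)) (cong (_· x ⁻¹) (⁻¹-involutive y))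

    quotient-chain : ∀ x y z → (x · y ⁻¹) · (y · z ⁻¹) ≡ x · z ⁻¹
    quotient-chain x y z =
      trans (sym (assoc (x · y ⁻¹) y (z ⁻¹))) (cong (_· z ⁻¹) (//-rightDividesˡ y x))

    quotient-translateʳ : ∀ x y k → (x · k) · (y · k) ⁻¹ ≡ x · y ⁻¹
    quotient-translateʳ x y k = begin
      (x · k) · (y · k) ⁻¹      ≡⟨ cong ((x · k) ·_) (⁻¹-anti-homo-∙ y k) ⟩
      (x · k) · (k ⁻¹ · y ⁻¹)   ≡⟨ assoc x k _ ⟩
      x · (k · (k ⁻¹ · y ⁻¹))   ≡⟨ cong (x ·_) (\\-leftDividesˡ k (y ⁻¹)) ⟩
      x · y ⁻¹                  ∎

    conj : Fin N → Fin N → Fin N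
    conj g k = (g · k) · g ⁻¹

    conj-· : ∀ g k₁ k₂ → conj g k₁ · conj g k₂ ≡ conj g (k₁ · k₂)
    conj-· g k₁ k₂ = begin
      ((g · k₁) · g ⁻¹) · ((g · k₂) · g ⁻¹)   ≡⟨ sym (assoc _ _ _) ⟩
      (((g · k₁) · g ⁻¹) · (g · k₂)) · g ⁻¹   ≡⟨ cong (_· g ⁻¹) (assoc _ _ _) ⟩
      ((g · k₁) · (g ⁻¹ · (g · k₂))) · g ⁻¹   ≡⟨ cong (λ z → ((g · k₁) · z) · g ⁻¹) (\\-leftDividesʳ g k₂) ⟩
      ((g · k₁) · k₂) · g ⁻¹                  ≡⟨ cong (_· g ⁻¹) (assoc g k₁ k₂) ⟩
      (g · (k₁ · k₂)) · g ⁻¹                  ∎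

    conj-conj : ∀ g h k → conj (g · h) k ≡ conj g (conj h k)
    conj-conj g h k = begin
      ((g · h) · k) · (g · h) ⁻¹        ≡⟨ cong (((g · h) · k) ·_) (⁻¹-anti-homo-∙ g h) ⟩
      ((g · h) · k) · (h ⁻¹ · g ⁻¹)     ≡⟨ sym (assoc _ _ _) ⟩
      (((g · h) · k) · h ⁻¹) · g ⁻¹     ≡⟨ cong (λ z → (z · h ⁻¹) · g ⁻¹) (assoc g h k) ⟩
      ((g · (h · k)) · h ⁻¹) · g ⁻¹     ≡⟨ cong (_· g ⁻¹) (assoc g _ _) ⟩
      (g · ((h · k) · h ⁻¹)) · g ⁻¹     ∎

  record DecSubgroup {N} (G : FinGroup N) : Set where
    open FinGroup G
    field
      member : Fin N → Bool
      e∈     : T (member e)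
      ·∈     : ∀ {x y} → T (member x) → T (member y) → T (member (x · y))
      ⁻¹∈    : ∀ {x} → T (member x) → T (member (x ⁻¹))

  module _ {N} {G : FinGroup N} where
    open FinGroup G

    infix 4 _∈_ _⊆_

    _∈_ : Fin N → DecSubgroup G → Set
    x ∈ K = T (DecSubgroup.member K x)

    _⊆_ : DecSubgroup G → DecSubgroup G → Set
    K ⊆ L = ∀ x → x ∈ K → x ∈ L

    order : DecSubgroup G → ℕ
    order K = count (DecSubgroup.member K)

    ∈-resp : (K : DecSubgroup G) {x y : Fin N} → x ≡ y → x ∈ K → y ∈ K
    ∈-resp K = subst (_∈ K)

  whole : ∀ {N} (G : FinGroup N) → DecSubgroup G
  whole G = record { member = λ _ → true ; e∈ = _ ; ·∈ = λ _ _ → _ ; ⁻¹∈ = λ _ → _ }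

  trivial : ∀ {N} (G : FinGroup N) → DecSubgroup G
  trivial G = record
    { member = _== e
    ; e∈     = ==-refl e
    ; ·∈     = λ x=e y=e → ≡⇒== (trans (cong₂ _·_ (==⇒≡ x=e) (==⇒≡ y=e)) (identityˡ e))
    ; ⁻¹∈    = λ x=e → ≡⇒== (trans (cong _⁻¹ (==⇒≡ x=e)) ε⁻¹≈ε) }
    where open FinGroup G

  module Cosets {N} (G : FinGroup N) (K : DecSubgroup G) where
    open FinGroup G
    open DecSubgroup K

    infix 4 _~_

    _~_ : Fin N → Fin N → Set
    x ~ y = x · y ⁻¹ ∈ K

    ~-refl : ∀ x → x ~ x
    ~-refl x = ∈-resp K (sym (inverseʳ x)) e∈

    ~-sym : ∀ {x y} → x ~ y → y ~ x
    ~-sym {x} {y} p = ∈-resp K (quotient-inverse x y) (⁻¹∈ p)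

    ~-trans : ∀ {x y z} → x ~ y → y ~ z → x ~ z
    ~-trans {x} {y} {z} p q = ∈-resp K (quotient-chain x y z) (·∈ p q)

    ~-translateʳ : ∀ {x y} k → x ~ y → x · k ~ y · k
    ~-translateʳ {x} {y} k = ∈-resp K (sym (quotient-translateʳ x y k))

    ∈⇒~e : ∀ {x} → x ∈ K → x ~ e
    ∈⇒~e {x} = ∈-resp K (sym (trans (cong (x ·_) ε⁻¹≈ε) (identityʳ x)))

    rep : Fin N → Fin N
    rep x = least (λ z → member (z · x ⁻¹)) (x , ~-refl x)

    rep-~ : ∀ x → rep x ~ x
    rep-~ x = least-∈ (λ z → member (z · x ⁻¹)) (x , ~-refl x)

    ~⇒rep≡ : ∀ {x y} → x ~ y → rep x ≡ rep y
    ~⇒rep≡ {x} {y} p = least-cong _ _ λ z → T-ext (λ q → ~-trans q p) (λ q → ~-trans q (~-sym p))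

    rep≡⇒~ : ∀ {x y} → rep x ≡ rep y → x ~ y
    rep≡⇒~ {x} {y} eq = ~-trans (~-sym (rep-~ x)) (subst (_~ y) (sym eq) (rep-~ y))

    rep-idem : ∀ x → rep (rep x) ≡ rep x
    rep-idem x = ~⇒rep≡ (rep-~ x)

    isRep : Fin N → Bool
    isRep y = rep y == y

    isRep-rep : ∀ x → T (isRep (rep x))
    isRep-rep x = ≡⇒== (rep-idem x)

    isRepIn : DecSubgroup G → Fin N → Bool
    isRepIn L y = isRep y ∧ DecSubgroup.member L y

    lagrange : (L : DecSubgroup G) → K ⊆ L → order L ≡ count (isRepIn L) * order K
    lagrange L K⊆L = trans (count-fibres L.member rep) (∑-const-on (isRepIn L) (order K) _ fibre)
      where
      module L = DecSubgroup L
      fibre : ∀ y → count (λ x → L.member x ∧ (rep x == y)) ≡ (if isRepIn L y then order K else 0)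
      fibre y with T? (isRepIn L y)
      ... | yes t rewrite T⇒≡true t = sym (count-bijection (_· y) (_· y ⁻¹)
            (λ k k∈K → ∧-intro (L.·∈ (K⊆L k k∈K) (∧-proj₂ {isRep y} t))
                               (≡⇒== (trans (~⇒rep≡ (∈-resp K (sym (//-rightDividesʳ y k)) k∈K)) ry)))
            (λ x q → rep≡⇒~ (trans (==⇒≡ (∧-proj₂ {L.member x} q)) (sym ry)))
            (λ k _ → //-rightDividesʳ y k)
            (λ x _ → //-rightDividesˡ y x))
        where
        ry : rep y ≡ y
        ry = ==⇒≡ (∧-proj₁ t)
      ... | no ¬t rewrite ¬T⇒≡false ¬t = count-empty λ x q → ¬t (fibre-over-rep x q)
        where
        fibre-over-rep : ∀ x → T (L.member x ∧ (rep x == y)) → T (isRepIn L y)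
        fibre-over-rep x q = ∧-intro (≡⇒== (trans (cong rep (sym rx≡y)) (trans (rep-idem x) rx≡y)))
                                     (∈-resp L (trans (//-rightDividesˡ x (rep x)) rx≡y) (L.·∈ (K⊆L _ (rep-~ x)) (∧-proj₁ q)))
          where
          rx≡y : rep x ≡ y
          rx≡y = ==⇒≡ (∧-proj₂ {L.member x} q)

    index : ℕ
    index = count isRep

    lagrange-whole : N ≡ index * order K
    lagrange-whole = begin
      N                                          ≡⟨ sym (count-const-true N) ⟩
      order (whole G)                            ≡⟨ lagrange (whole G) (λ _ _ → _) ⟩
      count (isRepIn (whole G)) * order K        ≡⟨ cong (_* order K) (count-cong (λ y → ∧-identityʳ (isRep y))) ⟩
      index * order K                            ∎
      where open ≡-Reasoning

module Powers where

  open import Algebra.Bundles using (Group)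
  import Algebra.Properties.Monoid.Mult as Mult
  open import Data.Bool using (Bool; true; T)
  open import Data.Fin using (Fin; toℕ; fromℕ<)
  open import Data.Fin.Properties using (pigeonhole; toℕ<n; toℕ-fromℕ<; toℕ-injective)
  open import Data.Nat using (ℕ; zero; suc; _+_; _*_; _∸_; _≤_; _<_; z≤n; s≤s; NonZero)
  open import Data.Nat.DivMod using (_%_; _/_; m≡m%n+[m/n]*n; m%n<n)
  open import Data.Nat.Divisibility using (_∣_; divides)
  open import Data.Nat.Properties
    using (≤-trans; ≤-reflexive; ≤-antisym; ≤-pred; <-irrefl; <-≤-trans; <-cmp; <⇒≤; n<1+n; n≤1+n; m≤n+m;
           +-suc; m+[n∸m]≡n)
  open import Data.Product using (∃; _×_; _,_; proj₁; proj₂)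
  open import Data.Empty using (⊥-elim)
  open import Function using (_∘_)
  open import Relation.Binary.Definitions using (tri<; tri≈; tri>)
  open import Relation.Binary.PropositionalEquality
  open Counting
  open FiniteGroups

  module _ {N} (G : FinGroup N) where
    open FinGroup G
    open Mult (Group.monoid group) using (×-homo-+; ×-assocˡ) renaming (_×_ to _times_)

    pow : Fin N → ℕ → Fin N
    pow g a = a times g

    pow-+ : ∀ g a b → pow g (a + b) ≡ pow g a · pow g b
    pow-+ = ×-homo-+

    pow-* : ∀ g a b → pow g (a * b) ≡ pow (pow g b) a
    pow-* g a b = sym (×-assocˡ g a b)

    pow-e : ∀ a → pow e a ≡ e
    pow-e zero = refl
    pow-e (suc a) = trans (identityˡ _) (pow-e a)

    pow-closed : (S : Fin N → Bool) → T (S e) → (∀ {x y} → T (S x) → T (S y) → T (S (x · y))) →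
                 ∀ {x} a → T (S x) → T (S (pow x a))
    pow-closed S e∈ ·∈ zero _ = e∈
    pow-closed S e∈ ·∈ (suc a) x∈S = ·∈ x∈S (pow-closed S e∈ ·∈ a x∈S)

    pow-∈ : (K : DecSubgroup G) {x : Fin N} (a : ℕ) → x ∈ K → pow x a ∈ K
    pow-∈ K = pow-closed member e∈ ·∈
      where open DecSubgroup K

    pow-cancel : ∀ g a c → pow g (a + c) ≡ pow g a → pow g c ≡ e
    pow-cancel g a c eq = ∙-cancelˡ (pow g a) _ _ (trans (sym (pow-+ g a c)) (trans eq (sym (identityʳ _))))

    module Period (g : Fin N) where
      private
        returns : Fin N → Bool
        returns a = pow g (suc (toℕ a)) == e

        some-return : ∃ λ a → T (returns a)
        some-return with pigeonhole (n<1+n N) (λ (i : Fin (suc N)) → pow g (toℕ i))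
        ... | i , j , i<j , eq = fromℕ< c<N , ≡⇒== (trans (cong (pow g ∘ suc) (toℕ-fromℕ< c<N)) g^[1+c]≡e)
          where
          c : ℕ
          c = toℕ j ∸ suc (toℕ i)
          j≡i+[1+c] : toℕ j ≡ toℕ i + suc c
          j≡i+[1+c] = trans (sym (m+[n∸m]≡n i<j)) (sym (+-suc (toℕ i) c))
          g^[1+c]≡e : pow g (suc c) ≡ e
          g^[1+c]≡e = pow-cancel g (toℕ i) (suc c) (trans (cong (pow g) (sym j≡i+[1+c])) (sym eq))
          c<j : c < toℕ j
          c<j = subst (c <_) (sym j≡i+[1+c]) (m≤n+m (suc c) (toℕ i))
          c<N : c < N
          c<N = <-≤-trans c<j (≤-pred (toℕ<n j))

      opaque
        period : ℕ
        period = suc (toℕ (least returns some-return))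

        pow-period : pow g period ≡ e
        pow-period = ==⇒≡ (least-∈ returns some-return)

        period≤size : period ≤ N
        period≤size = toℕ<n (least returns some-return)

        period-minimal : ∀ c → suc c < period → pow g (suc c) ≢ e
        period-minimal c lt eq = <-irrefl refl (≤-trans lt (s≤s
            (subst (toℕ (least returns some-return) ≤_) (toℕ-fromℕ< c<N)
              (least-minimal returns some-return (fromℕ< c<N)
                (≡⇒== (trans (cong (pow g ∘ suc) (toℕ-fromℕ< c<N)) eq))))))
          where
          c<N : c < N
          c<N = ≤-trans (n≤1+n (suc c)) (≤-trans lt period≤size)

        instance
          period≢0 : NonZero period
          period≢0 = _

      private
        pow-distinct : ∀ {a b} → a < b → b < period → pow g a ≢ pow g b
        pow-distinct {a} {b} a<b b<d eq =
          period-minimal c (≤-trans (s≤s (subst (suc c ≤_) (sym b≡a+[1+c]) (m≤n+m (suc c) a))) b<d)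
            (pow-cancel g a (suc c) (trans (cong (pow g) (sym b≡a+[1+c])) (sym eq)))
          where
          c : ℕ
          c = b ∸ suc a
          b≡a+[1+c] : b ≡ a + suc c
          b≡a+[1+c] = trans (sym (m+[n∸m]≡n a<b)) (sym (+-suc a c))

      pow-injective : ∀ {a b} → a < period → b < period → pow g a ≡ pow g b → a ≡ b
      pow-injective {a} {b} a<d b<d eq with <-cmp a b
      ... | tri≈ _ a≡b _ = a≡b
      ... | tri< a<b _ _ = ⊥-elim (pow-distinct a<b b<d eq)
      ... | tri> _ _ b<a = ⊥-elim (pow-distinct b<a a<d (sym eq))

      pow-multiple-period : ∀ r → pow g (r * period) ≡ e
      pow-multiple-period r = trans (pow-* g r period) (trans (cong (λ z → pow z r) pow-period) (pow-e r))

      pow-mod : ∀ a → pow g a ≡ pow g (a % period)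
      pow-mod a = begin
        pow g a                                          ≡⟨ cong (pow g) (m≡m%n+[m/n]*n a period) ⟩
        pow g (a % period + a / period * period)         ≡⟨ pow-+ g (a % period) (a / period * period) ⟩
        pow g (a % period) · pow g (a / period * period) ≡⟨ cong (pow g (a % period) ·_) (pow-multiple-period (a / period)) ⟩
        pow g (a % period) · e                           ≡⟨ identityʳ _ ⟩
        pow g (a % period)                               ∎
        where open ≡-Reasoning

      isPowerVia : Fin N → Fin period → Bool
      isPowerVia x i = pow g (toℕ i) == x

      isPower : Fin N → Bool
      isPower x = Any (isPowerVia x)

      isPower-pow : ∀ a → T (isPower (pow g a))
      isPower-pow a = Any-intro (isPowerVia (pow g a)) (fromℕ< (m%n<n a period))
        (≡⇒== (trans (cong (pow g) (toℕ-fromℕ< (m%n<n a period))) (sym (pow-mod a))))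

      isPower⇒pow : ∀ {x} → T (isPower x) → ∃ λ a → a < period × pow g a ≡ x
      isPower⇒pow {x} p with Any-elim (isPowerVia x) p
      ... | i , q = toℕ i , toℕ<n i , ==⇒≡ q

      cyclic : DecSubgroup G
      cyclic = record
        { member = isPower
        ; e∈     = isPower-pow 0
        ; ·∈     = ·∈
        ; ⁻¹∈    = ⁻¹∈ }
        where
        ·∈ : ∀ {x y} → T (isPower x) → T (isPower y) → T (isPower (x · y))
        ·∈ p q with isPower⇒pow p | isPower⇒pow q
        ... | a , _ , refl | b , _ , refl = subst (T ∘ isPower) (pow-+ g a b) (isPower-pow (a + b))
        ⁻¹∈ : ∀ {x} → T (isPower x) → T (isPower (x ⁻¹))
        ⁻¹∈ p with isPower⇒pow p
        ... | a , a<d , refl = subst (T ∘ isPower) (inverseʳ-unique (pow g a) _ g^a·g^[d∸a]≡e) (isPower-pow (period ∸ a))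
          where
          g^a·g^[d∸a]≡e : pow g a · pow g (period ∸ a) ≡ e
          g^a·g^[d∸a]≡e = trans (sym (pow-+ g a (period ∸ a))) (trans (cong (pow g) (m+[n∸m]≡n (<⇒≤ a<d))) pow-period)

      order-cyclic : order cyclic ≡ period
      order-cyclic = ≤-antisym
        (≤-trans (count-≤-injection {Q = λ (_ : Fin period) → true} (λ x p → proj₁ (Any-elim _ p)) (λ _ _ → _)
                   λ x y p q eq → trans (sym (==⇒≡ (proj₂ (Any-elim _ p))))
                                    (trans (cong (pow g ∘ toℕ) eq) (==⇒≡ (proj₂ (Any-elim _ q)))))
                 (≤-reflexive (count-const-true period)))
        (≤-trans (≤-reflexive (sym (count-const-true period)))
                 (count-≤-injection (λ i _ → pow g (toℕ i)) (λ i _ → isPower-pow (toℕ i))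
                   λ i j _ _ eq → toℕ-injective (pow-injective (toℕ<n i) (toℕ<n j) eq)))

      period∣size : period ∣ N
      period∣size = divides (Cosets.index G cyclic)
        (trans (Cosets.lagrange-whole G cyclic) (cong (Cosets.index G cyclic *_) order-cyclic))

    pow-size : ∀ g → pow g N ≡ e
    pow-size g with Period.period∣size g
    ... | divides r N≡r*d = trans (cong (pow g) N≡r*d) (Period.pow-multiple-period g r)

    ⁻¹-as-pow : ∀ x → ∃ λ a → x ⁻¹ ≡ pow x a
    ⁻¹-as-pow x = N ∸ 1 , sym (inverseʳ-unique x (pow x (N ∸ 1))
      (trans (cong (pow x) (m+[n∸m]≡n (≤-trans (s≤s z≤n) (toℕ<n e)))) (pow-size x)))

    submonoid→subgroup : (S : Fin N → Bool) → T (S e) → (∀ {x y} → T (S x) → T (S y) → T (S (x · y))) →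
                         DecSubgroup G
    submonoid→subgroup S e∈ ·∈ = record { member = S ; e∈ = e∈ ; ·∈ = ·∈ ; ⁻¹∈ = ⁻¹∈ }
      where
      ⁻¹∈ : ∀ {x} → T (S x) → T (S (x ⁻¹))
      ⁻¹∈ {x} x∈S with ⁻¹-as-pow x
      ... | a , eq = subst (T ∘ S) (sym eq) (pow-closed S e∈ ·∈ a x∈S)

module PGroups where

  open import Data.Bool using (Bool; true; false; T; _∧_; if_then_else_)
  open import Data.Empty using (⊥-elim)
  open import Data.Fin using (Fin; toℕ; fromℕ<; fromℕ)
  open import Data.Fin.Properties using (toℕ<n; toℕ-fromℕ<; toℕ-fromℕ; toℕ-injective)
  open import Data.Nat using (ℕ; zero; suc; _+_; _*_; _∸_; _^_; _≤_; _<_; s≤s; _≡ᵇ_; _<?_; NonZero)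
  open import Data.Nat.Divisibility using (_∣_; divides; _∣?_; ∣1⇒≡1; ∣m+n∣m⇒∣n; m∣m*n; ∣⇒≤)
  open import Data.Nat.Primality using (Prime; prime⇒irreducible; prime⇒nonZero; prime⇒nonTrivial)
  open import Data.Nat.Base using (nonTrivial⇒n>1; >-nonZero)
  open import Data.Nat.DivMod using (_%_; _/_; m≡m%n+[m/n]*n; m%n<n)
  open import Data.Nat.Coprimality using (Coprime; coprime-divisor; coprime-Bézout; prime⇒coprime)
  open import Data.Nat.GCD using (module Bézout)
  open import Data.Nat.Properties
    using (≤-refl; ≤-trans; ≤-reflexive; ≤-antisym; <-irrefl; <-trans; <-cmp; <⇒≤; n<1+n; m≤m+n;
           +-comm; +-suc; m+[n∸m]≡n; *-comm; *-suc; *-zeroʳ; *-cancelʳ-≡; *-monoʳ-≤;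
           *-identityʳ; ^-*-assoc; ^-distribˡ-+-*; ^-monoʳ-≤; m^n≢0; ≡ᵇ⇒≡; ≡⇒≡ᵇ)
  open import Relation.Binary.Definitions using (tri<; tri≈; tri>)
  open import Data.Product using (Σ; ∃; _×_; _,_; proj₁; proj₂)
  open import Data.Sum using (_⊎_; inj₁; inj₂)
  open import Function using (_∘_)
  open import Relation.Nullary using (¬_; Dec; yes; no)
  open import Relation.Nullary.Decidable using (T?)
  open import Relation.Binary.PropositionalEquality
  open Counting
  open FiniteGroups
  open Powers

  ∣prime^⇒≡1⊎prime∣ : ∀ {p} → Prime p → ∀ j d → d ∣ p ^ j → d ≡ 1 ⊎ p ∣ d
  ∣prime^⇒≡1⊎prime∣ pr zero d d∣1 = inj₁ (∣1⇒≡1 d∣1)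
  ∣prime^⇒≡1⊎prime∣ {p} pr (suc j) d d∣p^[1+j] with p ∣? d
  ... | yes p∣d = inj₂ p∣d
  ... | no p∤d = ∣prime^⇒≡1⊎prime∣ pr j d (coprime-divisor coprime d∣p^[1+j])
    where
    coprime : Coprime d p
    coprime {i} (i∣d , i∣p) with prime⇒irreducible pr i∣p
    ... | inj₁ i≡1 = i≡1
    ... | inj₂ refl = ⊥-elim (p∤d i∣d)

  ≡1⊎p∣⇒≡indicator+p* : ∀ {p c} → 1 < p → c ≡ 1 ⊎ p ∣ c → ∃ λ w → c ≡ indicator (c ≡ᵇ 1) + p * w
  ≡1⊎p∣⇒≡indicator+p* {p} _ (inj₁ refl) = 0 , cong suc (sym (*-zeroʳ p))
  ≡1⊎p∣⇒≡indicator+p* {p} p>1 (inj₂ (divides w refl)) with w * p ≡ᵇ 1 in eq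
  ... | true = ⊥-elim (<-irrefl refl (≤-trans p>1 (≤-reflexive (∣1⇒≡1 (divides w w*p≡1)))))
    where
    w*p≡1 : 1 ≡ w * p
    w*p≡1 = sym (≡ᵇ⇒≡ _ _ (subst T (sym eq) _))
  ... | false = w , *-comm w p

  prime^>1 : ∀ {p k} → Prime p → 1 ≤ k → 1 < p ^ k
  prime^>1 {p} {k} p-prime 1≤k = ≤-trans (nonTrivial⇒n>1 p {{prime⇒nonTrivial p-prime}})
    (≤-trans (≤-reflexive (sym (*-identityʳ p))) (^-monoʳ-≤ p {{prime⇒nonZero p-prime}} 1≤k))

  module CosetAction {N} (G : FinGroup N) (K : DecSubgroup G) where
    open FinGroup G
    open DecSubgroup K
    open Cosets G K

    rep-translate : ∀ {x y} k → x ~ y → rep (x · k) ≡ rep (y · k)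
    rep-translate k = ~⇒rep≡ ∘ ~-translateʳ k

    inOrbit : Fin N → Fin N → Bool
    inOrbit r s = isRep s ∧ Any (λ k → member k ∧ (rep (r · k) == s))

    inOrbit-intro : ∀ r {k} → k ∈ K → T (inOrbit r (rep (r · k)))
    inOrbit-intro r {k} k∈K = ∧-intro (isRep-rep (r · k)) (Any-intro _ k (∧-intro k∈K (==-refl (rep (r · k)))))

    inOrbit-elim : ∀ r s → T (inOrbit r s) → ∃ λ k → k ∈ K × rep (r · k) ≡ s
    inOrbit-elim r s t with Any-elim _ (∧-proj₂ {isRep s} t)
    ... | k , q = k , ∧-proj₁ q , ==⇒≡ (∧-proj₂ {member k} q)

    inOrbit-refl : ∀ {r} → T (isRep r) → T (inOrbit r r)
    inOrbit-refl {r} r-rep = subst (T ∘ inOrbit r) (trans (cong rep (identityʳ r)) (==⇒≡ r-rep)) (inOrbit-intro r e∈)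

    inOrbit-sym : ∀ {r s} → T (isRep r) → T (inOrbit r s) → T (inOrbit s r)
    inOrbit-sym {r} {s} r-rep t with inOrbit-elim r s t
    ... | k , k∈K , refl = subst (T ∘ inOrbit (rep (r · k))) back (inOrbit-intro (rep (r · k)) (⁻¹∈ k∈K))
      where
      back : rep (rep (r · k) · k ⁻¹) ≡ r
      back = trans (rep-translate (k ⁻¹) (rep-~ (r · k)))
                   (trans (cong rep (//-rightDividesʳ k r)) (==⇒≡ r-rep))

    inOrbit-trans : ∀ {r s t} → T (inOrbit r s) → T (inOrbit s t) → T (inOrbit r t)
    inOrbit-trans {r} {s} {t} rs st with inOrbit-elim r s rs | inOrbit-elim s t st
    ... | k₀ , k₀∈K , refl | k₁ , k₁∈K , refl = subst (T ∘ inOrbit r) r·k₀k₁ (inOrbit-intro r (·∈ k₀∈K k₁∈K))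
      where
      r·k₀k₁ : rep (r · (k₀ · k₁)) ≡ rep (rep (r · k₀) · k₁)
      r·k₀k₁ = trans (cong rep (sym (assoc r k₀ k₁))) (rep-translate k₁ (~-sym (rep-~ (r · k₀))))

    orbitRep : Fin N → Fin N
    orbitRep r = least (inOrbit r) (rep (r · e) , inOrbit-intro r e∈)

    orbitRep-∈ : ∀ r → T (inOrbit r (orbitRep r))
    orbitRep-∈ r = least-∈ (inOrbit r) (rep (r · e) , inOrbit-intro r e∈)

    orbitRep-cong : ∀ {r s} → T (isRep r) → T (inOrbit r s) → orbitRep s ≡ orbitRep r
    orbitRep-cong {r} {s} r-rep rs = least-cong _ _ λ t →
      T-ext (inOrbit-trans rs) (inOrbit-trans (inOrbit-sym r-rep rs))

    stabiliser : Fin N → DecSubgroup G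
    stabiliser r = submonoid→subgroup G (λ k → member k ∧ member (conj r k))
      (∧-intro e∈ (∈-resp K (sym (trans (cong (_· r ⁻¹) (identityʳ r)) (inverseʳ r))) e∈))
      (λ {x} {y} p q → ∧-intro (·∈ (∧-proj₁ p) (∧-proj₁ q))
                               (∈-resp K (conj-· r x y) (·∈ (∧-proj₂ {member x} p) (∧-proj₂ {member y} q))))

    orbit-stabiliser : ∀ r → order K ≡ count (inOrbit r) * order (stabiliser r)
    orbit-stabiliser r = trans (count-fibres member (λ k → rep (r · k))) (∑-const-on _ _ _ fibre)
      where
      fibre : ∀ s → count (λ k → member k ∧ (rep (r · k) == s)) ≡
                    (if inOrbit r s then order (stabiliser r) else 0)
      fibre s with T? (inOrbit r s)
      ... | no ¬rs rewrite ¬T⇒≡false ¬rs =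
            count-empty λ k q → ¬rs (subst (T ∘ inOrbit r) (==⇒≡ (∧-proj₂ {member k} q))
                                           (inOrbit-intro r (∧-proj₁ q)))
      ... | yes rs rewrite T⇒≡true rs with inOrbit-elim r s rs
      ... | k₀ , k₀∈K , refl = sym (count-bijection (_· k₀) (_· k₀ ⁻¹) into back
                                      (λ k _ → //-rightDividesʳ k₀ k) (λ k _ → //-rightDividesˡ k₀ k))
        where
        into : ∀ t → T (member t ∧ member (conj r t)) →
                     T (member (t · k₀) ∧ (rep (r · (t · k₀)) == rep (r · k₀)))
        into t q = ∧-intro (·∈ (∧-proj₁ q) k₀∈K) (≡⇒== (~⇒rep≡ (∈-resp K eq (∧-proj₂ {member t} q))))
          where
          eq : conj r t ≡ (r · (t · k₀)) · (r · k₀) ⁻¹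
          eq = sym (trans (cong (λ z → z · (r · k₀) ⁻¹) (sym (assoc r t k₀))) (quotient-translateʳ (r · t) r k₀))
        back : ∀ k → T (member k ∧ (rep (r · k) == rep (r · k₀))) →
                     T (member (k · k₀ ⁻¹) ∧ member (conj r (k · k₀ ⁻¹)))
        back k q = ∧-intro (·∈ (∧-proj₁ q) (⁻¹∈ k₀∈K)) (∈-resp K eq (rep≡⇒~ (==⇒≡ (∧-proj₂ {member k} q))))
          where
          eq : (r · k) · (r · k₀) ⁻¹ ≡ conj r (k · k₀ ⁻¹)
          eq = trans (cong (λ z → (r · z) · (r · k₀) ⁻¹) (sym (//-rightDividesˡ k₀ k)))
                     (trans (cong (λ z → z · (r · k₀) ⁻¹) (sym (assoc r (k · k₀ ⁻¹) k₀)))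
                            (quotient-translateʳ (r · (k · k₀ ⁻¹)) r k₀))

  -- K acts on its right cosets by right multiplication and every orbit has 1 or a multiple of p
  -- elements, so the number of fixed cosets is ≡ [G : K] ≡ 0 (mod p). The coset K is fixed, hence
  -- so is some other coset Kg, and then g ∉ K normalises K.
  module NormaliserEscape {N} (G : FinGroup N) {p} (prime : Prime p) (K : DecSubgroup G) (j : ℕ)
                          (order-K : order K ≡ p ^ j) (p∣index : p ∣ Cosets.index G K) where
    open FinGroup G
    open DecSubgroup K
    open Cosets G K
    open CosetAction G K

    p>1 : 1 < p
    p>1 = nonTrivial⇒n>1 p {{prime⇒nonTrivial prime}}

    orbit-size : ∀ r → count (inOrbit r) ≡ 1 ⊎ p ∣ count (inOrbit r)
    orbit-size r = ∣prime^⇒≡1⊎prime∣ prime j _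
      (divides (order (stabiliser r)) (trans (sym order-K) (trans (orbit-stabiliser r) (*-comm (count (inOrbit r)) _))))

    isOrbitRep : Fin N → Bool
    isOrbitRep t = isRep t ∧ (orbitRep t == t)

    isFixedRep : Fin N → Bool
    isFixedRep t = isOrbitRep t ∧ (count (inOrbit t) ≡ᵇ 1)

    private
      orbit : Fin N → Fin N → Bool
      orbit t r = isRep r ∧ (orbitRep r == t)

      orbit-∈⇒orbitRep : ∀ {r t} → T (orbit t r) → T (inOrbit r t)
      orbit-∈⇒orbitRep {r} q = subst (T ∘ inOrbit r) (==⇒≡ (∧-proj₂ {isRep r} q)) (orbitRep-∈ r)

      orbit-off-rep : ∀ t → ¬ T (isOrbitRep t) → count (orbit t) ≡ 0
      orbit-off-rep t ¬t = count-empty {P = orbit t} λ r q → ¬t (∧-intro (∧-proj₁ (orbit-∈⇒orbitRep q))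
        (≡⇒== (trans (orbitRep-cong (∧-proj₁ q) (orbit-∈⇒orbitRep q)) (==⇒≡ (∧-proj₂ {isRep r} q)))))

      orbit-at-rep : ∀ t → T (isOrbitRep t) → count (orbit t) ≡ count (inOrbit t)
      orbit-at-rep t t-orbitRep = count-cong {P = orbit t} {Q = inOrbit t} λ r → T-ext (into r) (back r)
        where
        t-rep : T (isRep t)
        t-rep = ∧-proj₁ {isRep t} t-orbitRep
        into : ∀ r → T (orbit t r) → T (inOrbit t r)
        into r q = inOrbit-sym {r} {t} (∧-proj₁ {isRep r} q) (orbit-∈⇒orbitRep {r} {t} q)
        back : ∀ r → T (inOrbit t r) → T (orbit t r)
        back r q = ∧-intro {isRep r} (∧-proj₁ {isRep r} q)
          (≡⇒== (trans (orbitRep-cong {t} {r} t-rep q) (==⇒≡ (∧-proj₂ {isRep t} t-orbitRep))))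

      orbit-mod-p : ∀ t → ∃ λ w → count (orbit t) ≡ indicator (isFixedRep t) + p * w
      orbit-mod-p t = by-cases (T? (isOrbitRep t))
        where
        trivial-orbit : Bool
        trivial-orbit = count (inOrbit t) ≡ᵇ 1
        by-cases : Dec (T (isOrbitRep t)) → ∃ λ w → count (orbit t) ≡ indicator (isFixedRep t) + p * w
        by-cases (no ¬t) = 0 , trans (orbit-off-rep t ¬t)
          (sym (cong₂ _+_ (cong (λ b → indicator (b ∧ trivial-orbit)) (¬T⇒≡false ¬t)) (*-zeroʳ p)))
        by-cases (yes t-rep) =
          let w , size≡ = ≡1⊎p∣⇒≡indicator+p* {p} {count (inOrbit t)} p>1 (orbit-size t) in
          w , trans (orbit-at-rep t t-rep)
                    (trans size≡ (cong (λ b → indicator (b ∧ trivial-orbit) + p * w) (sym (T⇒≡true t-rep))))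

    index-mod-p : ∃ λ w → index ≡ count isFixedRep + p * w
    index-mod-p =
      let w , ∑≡ = ∑≡count-mod p (count ∘ orbit) isFixedRep orbit-mod-p in
      w , trans (count-fibres isRep orbitRep) ∑≡

    p∣fixed : p ∣ count isFixedRep
    p∣fixed =
      let w , index≡ = index-mod-p in
      ∣m+n∣m⇒∣n (subst (p ∣_) (trans index≡ (+-comm _ (p * w))) p∣index) (m∣m*n w)

    private
      t₀ : Fin N
      t₀ = rep e

      orbit-t₀ : ∀ s → T (inOrbit t₀ s) → s ≡ t₀
      orbit-t₀ s q =
        let k , k∈K , t₀k≡s = inOrbit-elim t₀ s q in
        trans (sym t₀k≡s) (trans (rep-translate k (rep-~ e)) (trans (cong rep (identityˡ k)) (~⇒rep≡ (∈⇒~e k∈K))))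

      t₀-fixed : T (isFixedRep t₀)
      t₀-fixed = ∧-intro (∧-intro (isRep-rep e) (≡⇒== (orbit-t₀ _ (orbitRep-∈ t₀)))) (≡⇒≡ᵇ _ _ size≡1)
        where
        size≡1 : count (inOrbit t₀) ≡ 1
        size≡1 = trans (count-cong {P = inOrbit t₀} {Q = _== t₀} λ s → T-ext (≡⇒== ∘ orbit-t₀ s)
                          (λ q → subst (T ∘ inOrbit t₀) (sym (==⇒≡ q)) (inOrbit-refl (isRep-rep e))))
                       (count-singleton t₀)

      two-fixed : 2 ≤ count isFixedRep
      two-fixed = ≤-trans p>1 (∣⇒≤ {{>-nonZero (count-witness isFixedRep t₀ t₀-fixed)}} p∣fixed)

    escape : ∃ λ g → ¬ g ∈ K × (∀ k → k ∈ K → conj g k ∈ K)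
    escape = t , t∉K , normalises
      where
      other = count≥2⇒other isFixedRep t₀ two-fixed
      t : Fin N
      t = proj₁ other
      t-fixed : T (isFixedRep t)
      t-fixed = proj₁ (proj₂ other)
      t-rep : T (isRep t)
      t-rep = ∧-proj₁ {isRep t} (∧-proj₁ {isOrbitRep t} t-fixed)
      t∉K : ¬ t ∈ K
      t∉K t∈K = proj₂ (proj₂ other) (trans (sym (==⇒≡ t-rep)) (~⇒rep≡ (∈⇒~e t∈K)))
      normalises : ∀ k → k ∈ K → conj t k ∈ K
      normalises k k∈K = rep≡⇒~ (trans (count≡1⇒unique (inOrbit t) t (inOrbit-refl t-rep)
                                          (≡ᵇ⇒≡ _ _ (∧-proj₂ {isOrbitRep t} t-fixed)) _ (inOrbit-intro t k∈K))
                                       (sym (==⇒≡ t-rep)))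

  module _ {N} {G : FinGroup N} (K : DecSubgroup G) where
    open FinGroup G
    open DecSubgroup K

    pow-*-∈ : ∀ {x} u a → pow G x a ∈ K → pow G x (u * a) ∈ K
    pow-*-∈ {x} u a x^a∈K = ∈-resp K (sym (pow-* G x u a)) (pow-∈ G K u x^a∈K)

    pow-difference-∈ : ∀ {x} A B → A ≡ 1 + B → pow G x A ∈ K → pow G x B ∈ K → x ∈ K
    pow-difference-∈ {x} A B A≡1+B x^A∈K x^B∈K = ∈-resp K
      (trans (cong (λ z → pow G x z · pow G x B ⁻¹) A≡1+B) (//-rightDividesʳ (pow G x B) x))
      (·∈ x^A∈K (⁻¹∈ x^B∈K))

    coprime-pow-∈ : ∀ {x p} c → Coprime p c → pow G x p ∈ K → pow G x c ∈ K → x ∈ K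
    coprime-pow-∈ {x} {p} c coprime x^p∈K x^c∈K with coprime-Bézout coprime
    ... | Bézout.+- u v eq = pow-difference-∈ (u * p) (v * c) (sym eq) (pow-*-∈ u p x^p∈K) (pow-*-∈ v c x^c∈K)
    ... | Bézout.-+ u v eq = pow-difference-∈ (v * c) (u * p) (sym eq) (pow-*-∈ v c x^c∈K) (pow-*-∈ u p x^p∈K)

  record StepElement {N} (G : FinGroup N) (p : ℕ) (K : DecSubgroup G) : Set where
    open FinGroup G
    field
      h          : Fin N
      h∉K        : ¬ h ∈ K
      h^p∈K      : pow G h p ∈ K
      normalises : ∀ a k → k ∈ K → conj (pow G h a) k ∈ K

  module FindStep {N} (G : FinGroup N) {p} (m : ℕ) (N≡p^m : N ≡ p ^ m) (K : DecSubgroup G)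
                  (g : Fin N) (g∉K : ¬ g ∈ K) (g-normalises : ∀ k → k ∈ K → FinGroup.conj G g k ∈ K) where
    open FinGroup G
    open DecSubgroup K

    conj-pow-∈ : ∀ a k → k ∈ K → conj (pow G g a) k ∈ K
    conj-pow-∈ zero k k∈K = ∈-resp K (sym (trans (cong ((e · k) ·_) ε⁻¹≈ε) (trans (identityʳ _) (identityˡ k)))) k∈K
    conj-pow-∈ (suc a) k k∈K = ∈-resp K (sym (conj-conj g (pow G g a) k)) (g-normalises _ (conj-pow-∈ a k k∈K))

    private
      -- h will be g^(p^(t-1)) for the least t with g^(p^t) ∈ K; such t ≤ m exists as g^|G| = e.
      returns : Fin (suc m) → Bool
      returns t = member (pow G g (p ^ toℕ t))

      returns-at-m : T (returns (fromℕ m))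
      returns-at-m = ∈-resp K (sym (trans (cong (λ z → pow G g (p ^ z)) (toℕ-fromℕ m))
                                     (trans (cong (pow G g) (sym N≡p^m)) (pow-size G g)))) e∈

      first-return : Fin (suc m)
      first-return = least returns (fromℕ m , returns-at-m)

      step-from : ∀ t → toℕ first-return ≡ suc t → StepElement G p K
      step-from t eq = record
        { h          = pow G g (p ^ t)
        ; h∉K        = λ h∈K → <-irrefl refl (subst (_≤ t) eq (subst (toℕ first-return ≤_) (toℕ-fromℕ< t<1+m)
                         (least-minimal returns _ (fromℕ< t<1+m)
                           (subst (λ z → pow G g (p ^ z) ∈ K) (sym (toℕ-fromℕ< t<1+m)) h∈K))))
        ; h^p∈K      = ∈-resp K (trans (cong (λ z → pow G g (p ^ z)) eq) (pow-* G g p (p ^ t)))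
                          (least-∈ returns (fromℕ m , returns-at-m))
        ; normalises = λ a k k∈K → subst (λ z → conj z k ∈ K) (pow-* G g a (p ^ t)) (conj-pow-∈ (a * p ^ t) k k∈K) }
        where
        t<1+m : t < suc m
        t<1+m = <-trans (n<1+n t) (subst (_< suc m) eq (toℕ<n first-return))

      first-return≢0 : toℕ first-return ≢ 0
      first-return≢0 eq = g∉K (∈-resp K (identityʳ g)
        (subst (λ z → pow G g (p ^ z) ∈ K) eq (least-∈ returns (fromℕ m , returns-at-m))))

    stepElement : StepElement G p K
    stepElement = by-cases (toℕ first-return) refl
      where
      by-cases : ∀ n → toℕ first-return ≡ n → StepElement G p K
      by-cases zero eq = ⊥-elim (first-return≢0 eq)
      by-cases (suc t) eq = step-from t eq

  module Extension {N} (G : FinGroup N) {p} (prime : Prime p) (K : DecSubgroup G) (s : StepElement G p K) where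
    open FinGroup G
    open DecSubgroup K
    open Cosets G K
    open StepElement s

    instance
      p≢0 : NonZero p
      p≢0 = prime⇒nonZero prime

    private
      h^ : ℕ → Fin N
      h^ = pow G h

    h^-~-mod : ∀ n → h^ n ~ h^ (n % p)
    h^-~-mod n = ∈-resp K (sym eq) (normalises (n % p) _ (pow-*-∈ K (n / p) p h^p∈K))
      where
      open ≡-Reasoning
      eq : h^ n · h^ (n % p) ⁻¹ ≡ conj (h^ (n % p)) (h^ (n / p * p))
      eq = begin
        h^ n · h^ (n % p) ⁻¹                              ≡⟨ cong (λ z → h^ z · h^ (n % p) ⁻¹) (m≡m%n+[m/n]*n n p) ⟩
        h^ (n % p + n / p * p) · h^ (n % p) ⁻¹            ≡⟨ cong (_· h^ (n % p) ⁻¹) (pow-+ G h (n % p) (n / p * p)) ⟩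
        (h^ (n % p) · h^ (n / p * p)) · h^ (n % p) ⁻¹     ∎

    h^-distinct : ∀ {a b} → a < b → b < p → ¬ h^ b ~ h^ a
    h^-distinct {a} {b} a<b b<p h^b~h^a = h∉K (coprime-pow-∈ K (suc c) (prime⇒coprime prime c+1<p) h^p∈K h^[1+c]∈K)
      where
      c : ℕ
      c = b ∸ suc a
      b≡1+c+a : b ≡ suc c + a
      b≡1+c+a = trans (sym (m+[n∸m]≡n a<b)) (cong suc (+-comm a c))
      c+1<p : suc c < p
      c+1<p = ≤-trans (s≤s (subst (suc c ≤_) (sym b≡1+c+a) (m≤m+n (suc c) a))) b<p
      h^[1+c]∈K : h^ (suc c) ∈ K
      h^[1+c]∈K = ∈-resp K (trans (cong (λ z → h^ z · h^ a ⁻¹) b≡1+c+a)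
                           (trans (cong (_· h^ a ⁻¹) (pow-+ G h (suc c) a)) (//-rightDividesʳ (h^ a) (h^ (suc c)))))
                         h^b~h^a

    h^-~-injective : ∀ {a b} → a < p → b < p → h^ a ~ h^ b → a ≡ b
    h^-~-injective {a} {b} a<p b<p h^a~h^b with <-cmp a b
    ... | tri≈ _ a≡b _ = a≡b
    ... | tri< a<b _ _ = ⊥-elim (h^-distinct a<b b<p (~-sym h^a~h^b))
    ... | tri> _ _ b<a = ⊥-elim (h^-distinct b<a a<p h^a~h^b)

    inCosetOf : Fin N → Fin p → Bool
    inCosetOf x a = member (x · h^ (toℕ a) ⁻¹)

    inExtension : Fin N → Bool
    inExtension x = Any (inCosetOf x)

    inExtension-intro : ∀ x n → x ~ h^ n → T (inExtension x)
    inExtension-intro x n x~h^n = Any-intro (inCosetOf x) (fromℕ< (m%n<n n p))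
      (subst (λ z → x ~ h^ z) (sym (toℕ-fromℕ< (m%n<n n p))) (~-trans x~h^n (h^-~-mod n)))

    ·-~-h^ : ∀ {x y} a b → x ~ h^ a → y ~ h^ b → x · y ~ h^ (a + b)
    ·-~-h^ {x} {y} a b x~h^a y~h^b =
      ∈-resp K eq (·∈ x~h^a (normalises a (y · h^ b ⁻¹) y~h^b))
      where
      open ≡-Reasoning
      u = h^ a
      v = h^ b
      eq : (x · u ⁻¹) · conj u (y · v ⁻¹) ≡ (x · y) · h^ (a + b) ⁻¹
      eq = begin
        (x · u ⁻¹) · ((u · (y · v ⁻¹)) · u ⁻¹)    ≡⟨ sym (assoc _ _ _) ⟩
        ((x · u ⁻¹) · (u · (y · v ⁻¹))) · u ⁻¹    ≡⟨ cong (_· u ⁻¹) (assoc x (u ⁻¹) _) ⟩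
        (x · (u ⁻¹ · (u · (y · v ⁻¹)))) · u ⁻¹    ≡⟨ cong (λ z → (x · z) · u ⁻¹) (\\-leftDividesʳ u _) ⟩
        (x · (y · v ⁻¹)) · u ⁻¹                   ≡⟨ cong (_· u ⁻¹) (sym (assoc x y (v ⁻¹))) ⟩
        ((x · y) · v ⁻¹) · u ⁻¹                   ≡⟨ assoc _ _ _ ⟩
        (x · y) · (v ⁻¹ · u ⁻¹)                   ≡⟨ cong ((x · y) ·_) (sym (⁻¹-anti-homo-∙ u v)) ⟩
        (x · y) · (u · v) ⁻¹                      ≡⟨ cong (λ z → (x · y) · z ⁻¹) (sym (pow-+ G h a b)) ⟩
        (x · y) · h^ (a + b) ⁻¹                   ∎

    extension : DecSubgroup G
    extension = submonoid→subgroup G inExtension (inExtension-intro e 0 (~-refl e)) ·-closed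
      where
      ·-closed : ∀ {x y} → T (inExtension x) → T (inExtension y) → T (inExtension (x · y))
      ·-closed {x} {y} x∈ y∈ =
        let a , x~h^a = Any-elim (inCosetOf x) x∈
            b , y~h^b = Any-elim (inCosetOf y) y∈ in
        inExtension-intro (x · y) (toℕ a + toℕ b) (·-~-h^ (toℕ a) (toℕ b) x~h^a y~h^b)

    K⊆extension : K ⊆ extension
    K⊆extension k k∈K = inExtension-intro k 0 (∈⇒~e k∈K)

    index-extension : count (isRepIn extension) ≡ p
    index-extension = ≤-antisym
      (≤-trans (count-≤-injection {Q = λ (_ : Fin p) → true} (λ y q → coset y q) (λ _ _ → _)
                 λ y y′ q q′ eq → trans (sym (==⇒≡ (∧-proj₁ q)))
                                       (trans (~⇒rep≡ (same-coset y y′ q q′ eq)) (==⇒≡ (∧-proj₁ q′))))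
               (≤-reflexive (count-const-true p)))
      (≤-trans (≤-reflexive (sym (count-const-true p)))
               (count-≤-injection (λ a _ → rep (h^ (toℕ a)))
                 (λ a _ → ∧-intro (isRep-rep _) (inExtension-intro _ (toℕ a) (rep-~ _)))
                 λ a b _ _ eq → toℕ-injective (h^-~-injective (toℕ<n a) (toℕ<n b) (rep≡⇒~ eq))))
      where
      coset : ∀ y → T (isRepIn extension y) → Fin p
      coset y q = proj₁ (Any-elim (inCosetOf y) (∧-proj₂ {isRep y} q))
      coset-~ : ∀ y q → y ~ h^ (toℕ (coset y q))
      coset-~ y q = proj₂ (Any-elim (inCosetOf y) (∧-proj₂ {isRep y} q))
      same-coset : ∀ y y′ q q′ → coset y q ≡ coset y′ q′ → y ~ y′
      same-coset y y′ q q′ eq = ~-trans (coset-~ y q) (~-sym (subst (λ a → y′ ~ h^ (toℕ a)) (sym eq) (coset-~ y′ q′)))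

    order-extension : order extension ≡ p * order K
    order-extension = trans (lagrange extension K⊆extension) (cong (_* order K) index-extension)

  module SubgroupChain {N} (G : FinGroup N) {p} (prime : Prime p) (m : ℕ) (N≡p^m : N ≡ p ^ m) where
    open FinGroup G

    instance
      p≢0 : NonZero p
      p≢0 = prime⇒nonZero prime

    p∣index : (K : DecSubgroup G) (j : ℕ) → order K ≡ p ^ j → j < m → p ∣ Cosets.index G K
    p∣index K j order-K j<m = divides (p ^ c) (trans index≡p^[1+c] (*-comm p (p ^ c)))
      where
      open Cosets G K using (index; lagrange-whole)
      c : ℕ
      c = m ∸ suc j
      index≡p^[1+c] : index ≡ p ^ suc c
      index≡p^[1+c] = *-cancelʳ-≡ index (p ^ suc c) (p ^ j) {{m^n≢0 p j}} (begin
        index * p ^ j       ≡⟨ cong (index *_) (sym order-K) ⟩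
        index * order K     ≡⟨ sym lagrange-whole ⟩
        N                   ≡⟨ N≡p^m ⟩
        p ^ m               ≡⟨ cong (p ^_) (trans (sym (m+[n∸m]≡n j<m)) (+-comm (suc j) c)) ⟩
        p ^ (c + suc j)     ≡⟨ cong (p ^_) (+-suc c j) ⟩
        p ^ (suc c + j)     ≡⟨ ^-distribˡ-+-* p (suc c) j ⟩
        p ^ suc c * p ^ j   ∎)
        where open ≡-Reasoning

    grow : (K : DecSubgroup G) (j : ℕ) → order K ≡ p ^ j → j < m →
           Σ (DecSubgroup G) λ L → K ⊆ L × order L ≡ p ^ suc j
    grow K j order-K j<m = extension , K⊆extension , trans order-extension (cong (p *_) order-K)
      where
      escaping = NormaliserEscape.escape G prime K j order-K (p∣index K j order-K j<m)
      step = FindStep.stepElement G m N≡p^m K (proj₁ escaping) (proj₁ (proj₂ escaping)) (proj₂ (proj₂ escaping))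
      open Extension G prime K step

    private
      layer : (i : ℕ) → Σ (DecSubgroup G) λ K → i ≤ m → order K ≡ p ^ i
      layer zero = trivial G , λ _ → count-singleton e
      layer (suc i) with layer i | i <? m
      ... | K , order-K | yes i<m = let L , _ , order-L = grow K i (order-K (<⇒≤ i<m)) i<m in L , λ _ → order-L
      ... | K , _ | no i≮m = K , λ i<m → ⊥-elim (i≮m i<m)

    chain : ℕ → DecSubgroup G
    chain i = proj₁ (layer i)

    order-chain : ∀ i → i ≤ m → order (chain i) ≡ p ^ i
    order-chain i = proj₂ (layer i)

    chain-step : ∀ i → chain i ⊆ chain (suc i)
    chain-step i with layer i | i <? m
    ... | K , order-K | yes i<m = proj₁ (proj₂ (grow K i (order-K (<⇒≤ i<m)) i<m))
    ... | K , _ | no _ = λ _ x∈K → x∈K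

    chain-mono : ∀ d i → chain i ⊆ chain (d + i)
    chain-mono zero i _ x∈ = x∈
    chain-mono (suc d) i x x∈ = chain-step (d + i) x (chain-mono d i x x∈)

    chain-bottom : ∀ x → x ∈ chain 0 → x ≡ e
    chain-bottom x = ==⇒≡

    chain-top : ∀ x → x ∈ chain m
    chain-top = count≡size⇒all (DecSubgroup.member (chain m)) (trans (order-chain m ≤-refl) (sym N≡p^m))

  module CoarseChain {N} (G : FinGroup N) {p q k} (prime : Prime p) (q≡p^k : q ≡ p ^ k)
                     (n : ℕ) (N≡q^n : N ≡ q ^ n) where
    open FinGroup G

    q^≡p^ : ∀ i → q ^ i ≡ p ^ (k * i)
    q^≡p^ i = trans (cong (_^ i) q≡p^k) (^-*-assoc p k i)

    open SubgroupChain G prime (k * n) (trans N≡q^n (q^≡p^ n))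

    coarse : ℕ → DecSubgroup G
    coarse i = chain (k * i)

    coarse-step : ∀ i → coarse i ⊆ coarse (suc i)
    coarse-step i x x∈ = subst (λ j → x ∈ chain j) (sym (*-suc k i)) (chain-mono k (k * i) x x∈)

    order-coarse : ∀ i → i ≤ n → order (coarse i) ≡ q ^ i
    order-coarse i i≤n = trans (order-chain (k * i) (*-monoʳ-≤ k i≤n)) (sym (q^≡p^ i))

    coarse-bottom : ∀ x → x ∈ coarse 0 → x ≡ e
    coarse-bottom x x∈ = chain-bottom x (subst (λ j → x ∈ chain j) (*-zeroʳ k) x∈)

    coarse-top : ∀ x → x ∈ coarse n
    coarse-top = chain-top

module CosetCoordinates where

  open import Data.Bool using (Bool; T; _∧_)
  open import Data.Empty using (⊥-elim)
  open import Data.Fin using (Fin; toℕ; fromℕ<)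
  open import Data.Fin.Properties using (toℕ<n; toℕ-fromℕ<; toℕ-injective)
  open import Data.Nat using (ℕ; zero; suc; _+_; _*_; _∸_; _^_; _≤_; _<_; z≤n; s≤s; NonZero)
  open import Data.Nat.Properties
    using (≤-trans; ≤-reflexive; <-irrefl; <⇒≤; m≤n+m; +-suc; +-identityʳ; m∸n+n≡m; *-cancelʳ-≡; m^n≢0;
           m≤n⇒m<n∨m≡n; ≤-irrelevant)
  open import Data.Product using (∃; _×_; _,_; proj₁; proj₂)
  open import Data.Sum using ([_,_]′)
  open import Relation.Binary.PropositionalEquality
  open Counting
  open FiniteGroups

  module Coordinates {N} (G : FinGroup N) (q n : ℕ) {{q≢0 : NonZero q}} (H : ℕ → DecSubgroup G)
                     (H-step   : ∀ i → H i ⊆ H (suc i))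
                     (H-order  : ∀ i → i ≤ n → order (H i) ≡ q ^ i)
                     (H-bottom : ∀ x → x ∈ H 0 → x ≡ FinGroup.e G)
                     (H-top    : ∀ x → x ∈ H n) where
    open FinGroup G

    infix 4 _~[_]_

    _~[_]_ : Fin N → ℕ → Fin N → Set
    x ~[ i ] y = x · y ⁻¹ ∈ H i

    module Digit (i : ℕ) (i<n : i < n) where
      private
        module Hᵢ = Cosets G (H i)
        module Hᵢ₊₁ = Cosets G (H (suc i))

        -- The digit of x at level i is the H_i-coset of x · r⁻¹ ∈ H_{i+1}, where r represents the
        -- H_{i+1}-coset of x, numbered among the q cosets of H_i in H_{i+1}.
        offset : Fin N → Fin N
        offset x = x · Hᵢ₊₁.rep x ⁻¹

        offset-∈ : ∀ x → offset x ∈ H (suc i)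
        offset-∈ x = Hᵢ₊₁.~-sym (Hᵢ₊₁.rep-~ x)

        isDigitRep : Fin N → Bool
        isDigitRep = Hᵢ.isRepIn (H (suc i))

        digitRep-rep : ∀ x → x ∈ H (suc i) → T (isDigitRep (Hᵢ.rep x))
        digitRep-rep x x∈ = ∧-intro (Hᵢ.isRep-rep x)
          (∈-resp (H (suc i)) (//-rightDividesˡ x (Hᵢ.rep x))
            (DecSubgroup.·∈ (H (suc i)) (H-step i _ (Hᵢ.rep-~ x)) x∈))

        digit-count : count isDigitRep ≡ q
        digit-count = *-cancelʳ-≡ (count isDigitRep) q (q ^ i) {{m^n≢0 q i}}
          (trans (cong (count isDigitRep *_) (sym (H-order i (<⇒≤ i<n))))
            (trans (sym (Hᵢ.lagrange (H (suc i)) (H-step i))) (H-order (suc i) i<n)))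

        offset-quotient : ∀ {x y} → x ~[ suc i ] y → offset x · offset y ⁻¹ ≡ x · y ⁻¹
        offset-quotient {x} {y} x~y = trans (cong (λ z → offset x · (y · z ⁻¹) ⁻¹) (sym (Hᵢ₊₁.~⇒rep≡ x~y)))
                                            (quotient-translateʳ x y (Hᵢ₊₁.rep x ⁻¹))

      opaque
        digit : Fin N → Fin q
        digit x = subst Fin digit-count (rank isDigitRep (Hᵢ.rep (offset x)) (digitRep-rep _ (offset-∈ x)))

        digit-≡⇔ : ∀ {x y} → x ~[ suc i ] y → (x ~[ i ] y → digit x ≡ digit y) × (digit x ≡ digit y → x ~[ i ] y)
        digit-≡⇔ {x} {y} x~y =
            (λ x~ᵢy → cong (subst Fin digit-count)
                        (rank-cong isDigitRep (Hᵢ.~⇒rep≡ (∈-resp (H i) (sym (offset-quotient x~y)) x~ᵢy))))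
          , (λ eq → ∈-resp (H i) (offset-quotient x~y)
                      (Hᵢ.rep≡⇒~ (rank-injective isDigitRep (subst-injective {P = Fin} digit-count eq))))

        digit-realise : ∀ x₀ (a : Fin q) → ∃ λ x → x ~[ suc i ] x₀ × digit x ≡ a
        digit-realise x₀ a = x , x~x₀ , digit-x
          where
          w : Fin (count isDigitRep)
          w = subst Fin (sym digit-count) a
          z : Fin N
          z = unrank isDigitRep w
          z-rep : T (isDigitRep z)
          z-rep = unrank-∈ isDigitRep w
          x : Fin N
          x = z · Hᵢ₊₁.rep x₀
          x~x₀ : x ~[ suc i ] x₀
          x~x₀ = ∈-resp (H (suc i)) (sym (assoc z _ (x₀ ⁻¹)))
                   (DecSubgroup.·∈ (H (suc i)) (∧-proj₂ {Hᵢ.isRep z} z-rep) (Hᵢ₊₁.rep-~ x₀))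
          offset-x : offset x ≡ z
          offset-x = trans (cong (λ t → x · t ⁻¹) (Hᵢ₊₁.~⇒rep≡ x~x₀)) (//-rightDividesʳ (Hᵢ₊₁.rep x₀) z)
          digit-x : digit x ≡ a
          digit-x = trans (cong (subst Fin digit-count)
                            (trans (rank-cong isDigitRep (trans (cong Hᵢ.rep offset-x) (==⇒≡ (∧-proj₁ z-rep))))
                                   (rank-unrank isDigitRep w z-rep)))
                          (subst-subst-sym digit-count)

    coord : Fin N → Fin n → Fin q
    coord x k = Digit.digit (toℕ k) (toℕ<n k) x

    coord-fromℕ< : ∀ {i} (i<n : i < n) x → coord x (fromℕ< i<n) ≡ Digit.digit i i<n x
    coord-fromℕ< {i} i<n x = digit-cong (toℕ-fromℕ< i<n) (toℕ<n (fromℕ< i<n))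
      where
      digit-cong : ∀ {j} → j ≡ i → (j<n : j < n) → Digit.digit j j<n x ≡ Digit.digit i i<n x
      digit-cong refl j<n = cong (λ lt → Digit.digit i lt x) (≤-irrelevant j<n i<n)

    AgreeFrom : ℕ → Fin N → Fin N → Set
    AgreeFrom i x y = ∀ (k : Fin n) → i ≤ toℕ k → coord x k ≡ coord y k

    agreeFrom-n : ∀ x y → AgreeFrom n x y
    agreeFrom-n x y k n≤k = ⊥-elim (<-irrefl refl (≤-trans (toℕ<n k) n≤k))

    agreeFrom-suc : ∀ {i x y} (i<n : i < n) → AgreeFrom (suc i) x y →
                    Digit.digit i i<n x ≡ Digit.digit i i<n y → AgreeFrom i x y
    agreeFrom-suc {i} {x} {y} i<n agree eq k i≤k = [ agree k , at-i ]′ (m≤n⇒m<n∨m≡n i≤k)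
      where
      at-i : i ≡ toℕ k → coord x k ≡ coord y k
      at-i i≡k = subst (λ k′ → coord x k′ ≡ coord y k′) (toℕ-injective (trans (toℕ-fromℕ< i<n) i≡k))
                   (trans (coord-fromℕ< i<n x) (trans eq (sym (coord-fromℕ< i<n y))))

    ~⇔agreeFrom : ∀ d i → d + i ≡ n → ∀ x y → (x ~[ i ] y → AgreeFrom i x y) × (AgreeFrom i x y → x ~[ i ] y)
    ~⇔agreeFrom zero i refl x y = (λ _ → agreeFrom-n x y) , λ _ → H-top _
    ~⇔agreeFrom (suc d) i eq x y = into , back
      where
      i<n : i < n
      i<n = ≤-trans (s≤s (m≤n+m i d)) (≤-reflexive eq)
      above = ~⇔agreeFrom d (suc i) (trans (+-suc d i) eq) x y
      into : x ~[ i ] y → AgreeFrom i x y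
      into x~y = agreeFrom-suc i<n (proj₁ above (H-step i _ x~y)) (proj₁ (Digit.digit-≡⇔ i i<n (H-step i _ x~y)) x~y)
      back : AgreeFrom i x y → x ~[ i ] y
      back agree = proj₂ (Digit.digit-≡⇔ i i<n x~y) (trans (sym (coord-fromℕ< i<n x))
                     (trans (agree (fromℕ< i<n) (≤-reflexive (sym (toℕ-fromℕ< i<n)))) (coord-fromℕ< i<n y)))
        where
        x~y : x ~[ suc i ] y
        x~y = proj₂ above (λ k i<k → agree k (<⇒≤ i<k))

    ~⇒agreeFrom : ∀ {i} → i ≤ n → ∀ {x y} → x ~[ i ] y → AgreeFrom i x y
    ~⇒agreeFrom {i} i≤n {x} {y} = proj₁ (~⇔agreeFrom (n ∸ i) i (m∸n+n≡m i≤n) x y)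

    agreeFrom⇒~ : ∀ {i} → i ≤ n → ∀ {x y} → AgreeFrom i x y → x ~[ i ] y
    agreeFrom⇒~ {i} i≤n {x} {y} = proj₂ (~⇔agreeFrom (n ∸ i) i (m∸n+n≡m i≤n) x y)

    coord-injective : ∀ {x y} → (∀ k → coord x k ≡ coord y k) → x ≡ y
    coord-injective {x} {y} eq = ∙-cancelʳ (y ⁻¹) x y
      (trans (H-bottom _ (agreeFrom⇒~ z≤n (λ k _ → eq k))) (sym (inverseʳ y)))

    coord-realiseFrom : ∀ d i → d + i ≡ n → (a : Fin n → Fin q) →
                        ∃ λ x → ∀ (k : Fin n) → i ≤ toℕ k → coord x k ≡ a k
    coord-realiseFrom zero i refl a = e , λ k n≤k → ⊥-elim (<-irrefl refl (≤-trans (toℕ<n k) n≤k))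
    coord-realiseFrom (suc d) i eq a = x , agree
      where
      i<n : i < n
      i<n = ≤-trans (s≤s (m≤n+m i d)) (≤-reflexive eq)
      d+1+i≡n : d + suc i ≡ n
      d+1+i≡n = trans (+-suc d i) eq
      above = coord-realiseFrom d (suc i) d+1+i≡n a
      x₀ : Fin N
      x₀ = proj₁ above
      realised = Digit.digit-realise i i<n x₀ (a (fromℕ< i<n))
      x : Fin N
      x = proj₁ realised
      agree : ∀ k → i ≤ toℕ k → coord x k ≡ a k
      agree k i≤k = [ above-i , at-i ]′ (m≤n⇒m<n∨m≡n i≤k)
        where
        above-i : i < toℕ k → coord x k ≡ a k
        above-i i<k = trans (~⇒agreeFrom i<n (proj₁ (proj₂ realised)) k i<k) (proj₂ above k i<k)
        at-i : i ≡ toℕ k → coord x k ≡ a k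
        at-i i≡k = subst (λ k′ → coord x k′ ≡ a k′) (toℕ-injective (trans (toℕ-fromℕ< i<n) i≡k))
                     (trans (coord-fromℕ< i<n x) (proj₂ (proj₂ realised)))

    coord⁻¹ : (Fin n → Fin q) → Fin N
    coord⁻¹ a = proj₁ (coord-realiseFrom n 0 (+-identityʳ n) a)

    coord-coord⁻¹ : ∀ a k → coord (coord⁻¹ a) k ≡ a k
    coord-coord⁻¹ a k = proj₂ (coord-realiseFrom n 0 (+-identityʳ n) a) k z≤n

open import Defs hiding (_⊆_)
open import Level using (_⊔_; Lift; lift; lower)
open import Algebra.Bundles using (Group)
open import Data.Fin using (Fin; toℕ; inject₁) renaming (zero to fzero; suc to fsuc)
open import Data.Fin.Properties using (toℕ<n; toℕ-inject₁; toℕ-fromℕ)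
open import Data.Nat using (ℕ; suc; _*_; _^_; _≤_; _<_; z≤n; NonZero)
open import Data.Nat.Base using (>-nonZero)
open import Data.Nat.Properties
  using (≤-refl; ≤-trans; ≤-reflexive; <-irrefl; <⇒≤; *-comm; m^n≢0; m<m*n; module ≤-Reasoning)
open import Data.Product using (Σ; _,_)
open import Data.Sum using (inj₁; inj₂)
open import Function using (_∘_)
open import Function.Bundles using (Inverse; _⇔_; mk⇔)
open import Relation.Nullary using (¬_)
open import Relation.Binary.PropositionalEquality as ≡ using (_≡_)
open Counting
open FiniteGroups
open PGroups
open CosetCoordinates

module Transport {c ℓ} (G : Group c ℓ) {N} (|G| : HasCard (Group.setoid G) N) where
  open Group G
  open Inverse |G| using (to-cong; strictlyInverseˡ; strictlyInverseʳ) renaming (to to φ; from to ψ)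

  φ-injective : ∀ {x y} → φ x ≡ φ y → x ≈ y
  φ-injective {x} {y} eq = trans (sym (strictlyInverseʳ x)) (trans (reflexive (≡.cong ψ eq)) (strictlyInverseʳ y))

  -- G carried over to Fin N along its enumeration, so that its subsets become countable.
  finGroup : FinGroup N
  finGroup = record
    { _·_ = λ a b → φ (ψ a ∙ ψ b)
    ; e = φ ε
    ; _⁻¹ = λ a → φ (ψ a ⁻¹)
    ; isGroup = record
      { isMonoid = record
        { isSemigroup = record
          { isMagma = record { isEquivalence = ≡.isEquivalence ; ∙-cong = ≡.cong₂ (λ a b → φ (ψ a ∙ ψ b)) }
          ; assoc = λ a b c → to-cong (trans (∙-cong (strictlyInverseʳ _) refl)
                                      (trans (assoc _ _ _) (∙-cong refl (sym (strictlyInverseʳ _))))) }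
        ; identity = (λ a → ≡.trans (to-cong (trans (∙-cong (strictlyInverseʳ ε) refl) (identityˡ _))) (strictlyInverseˡ a))
                   , (λ a → ≡.trans (to-cong (trans (∙-cong refl (strictlyInverseʳ ε)) (identityʳ _))) (strictlyInverseˡ a)) }
      ; inverse = (λ a → to-cong (trans (∙-cong (strictlyInverseʳ _) refl) (inverseˡ _)))
                , (λ a → to-cong (trans (∙-cong refl (strictlyInverseʳ _)) (inverseʳ _)))
      ; ⁻¹-cong = ≡.cong (λ a → φ (ψ a ⁻¹)) } }

  open FinGroup finGroup using (_·_) renaming (_⁻¹ to _⁻¹′)

  φ-quotient : ∀ x y → φ (x ∙ y ⁻¹) ≡ φ x · φ y ⁻¹′
  φ-quotient x y = to-cong (∙-cong (sym (strictlyInverseʳ x))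
                                  (trans (⁻¹-cong (sym (strictlyInverseʳ y))) (sym (strictlyInverseʳ _))))

  toSubgroup : DecSubgroup finGroup → Subgroup G
  toSubgroup K = record
    { mem  = λ x → Lift (c ⊔ ℓ) (φ x ∈ K)
    ; resp = λ x≈y (lift x∈K) → lift (∈-resp K (to-cong x≈y) x∈K)
    ; ε∈   = lift e∈
    ; ∙∈   = λ (lift x∈K) (lift y∈K) →
               lift (∈-resp K (to-cong (∙-cong (strictlyInverseʳ _) (strictlyInverseʳ _))) (·∈ x∈K y∈K))
    ; ⁻¹∈  = λ (lift x∈K) → lift (∈-resp K (to-cong (⁻¹-cong (strictlyInverseʳ _))) (⁻¹∈ x∈K)) }
    where open DecSubgroup K

  order-toSubgroup : (K : DecSubgroup finGroup) → HasCard (subSetoid (toSubgroup K)) (order K)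
  order-toSubgroup K = record
    { to        = λ (x , lift x∈K) → rank member (φ x) x∈K
    ; from      = λ i → ψ (unrank member i) , lift (∈-resp K (≡.sym (strictlyInverseˡ _)) (unrank-∈ member i))
    ; to-cong   = λ eq → rank-cong member (to-cong eq)
    ; from-cong = λ eq → reflexive (≡.cong (ψ ∘ unrank member) eq)
    ; inverse   = (λ {i} eq → ≡.trans (rank-cong member (≡.trans (to-cong eq) (strictlyInverseˡ _)))
                                      (rank-unrank member i (unrank-∈ member i)))
                , (λ {(x , lift x∈K)} eq → trans (reflexive (≡.cong ψ (≡.trans (≡.cong (unrank member) eq)
                                                                          (unrank-rank member (φ x) x∈K))))
                                                 (strictlyInverseʳ x)) }
    where open DecSubgroup K

module ChainIsometry {c₁ ℓ₁ c₂ ℓ₂} (G : Group c₁ ℓ₁) (H : Group c₂ ℓ₂) {q n : ℕ}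
                     (|G| : HasCard (Group.setoid G) (q ^ n)) (|H| : HasCard (Group.setoid H) q) (q>1 : 1 < q)
                     (K : ℕ → DecSubgroup (Transport.finGroup G |G|))
                     (K-step   : ∀ i → K i ⊆ K (suc i))
                     (K-order  : ∀ i → i ≤ n → order (K i) ≡ q ^ i)
                     (K-bottom : ∀ x → x ∈ K 0 → x ≡ FinGroup.e (Transport.finGroup G |G|))
                     (K-top    : ∀ x → x ∈ K n) where
  open Transport G |G|
  open Inverse |G| using ()
    renaming (to to φ; from to ψ; to-cong to φ-cong; strictlyInverseˡ to φψ; strictlyInverseʳ to ψφ)
  open Inverse |H| using ()
    renaming (to to τ; from to χ; to-cong to τ-cong; strictlyInverseˡ to τχ; strictlyInverseʳ to χτ)
  module G = Group G
  module H = Group H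

  instance
    q≢0 : NonZero q
    q≢0 = >-nonZero (<⇒≤ q>1)

  open CosetCoordinates.Coordinates finGroup q n K K-step K-order K-bottom K-top

  Kᶠ : Fin (suc n) → Subgroup G
  Kᶠ i = toSubgroup (K (toℕ i))

  K-inject₁ : ∀ (j : Fin n) {x} → x ∈ K (toℕ (inject₁ j)) → x ∈ K (toℕ j)
  K-inject₁ j = ≡.subst (λ i → _ ∈ K i) (toℕ-inject₁ j)

  K-inject₁⁻ : ∀ (j : Fin n) {x} → x ∈ K (toℕ j) → x ∈ K (toℕ (inject₁ j))
  K-inject₁⁻ j = ≡.subst (λ i → _ ∈ K i) (≡.sym (toℕ-inject₁ j))

  K-strict : ∀ j → j < n → ¬ K (suc j) ⊆ K j
  K-strict j j<n K⊆ = <-irrefl ≡.refl (begin-strict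
    q ^ j              <⟨ m<m*n (q ^ j) q {{m^n≢0 q j}} q>1 ⟩
    q ^ j * q          ≡⟨ *-comm (q ^ j) q ⟩
    q ^ suc j          ≡⟨ ≡.sym (K-order (suc j) j<n) ⟩
    order (K (suc j))  ≤⟨ count-mono K⊆ ⟩
    order (K j)        ≡⟨ K-order j (<⇒≤ j<n) ⟩
    q ^ j              ∎)
    where open ≤-Reasoning

  chain : Chain G n q
  chain = record
    { H      = Kᶠ
    ; bottom = λ x → mk⇔ (λ (lift x∈) → φ-injective (K-bottom (φ x) x∈))
                         (λ x≈ε → lift (∈-resp (K 0) (≡.sym (φ-cong x≈ε)) (DecSubgroup.e∈ (K 0))))
    ; top    = λ x → lift (≡.subst (λ i → φ x ∈ K i) (≡.sym (toℕ-fromℕ n)) (K-top (φ x)))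
    ; incl   = λ j (lift x∈) → lift (K-step (toℕ j) _ (K-inject₁ j x∈))
    ; strict = λ j Kᶠ⊆ → K-strict (toℕ j) (toℕ<n j) λ y y∈ →
                 ∈-resp (K (toℕ j)) (φψ y)
                   (K-inject₁ j (lower (Kᶠ⊆ (lift (∈-resp (K (suc (toℕ j))) (≡.sym (φψ y)) y∈)))))
    ; index  = λ j → q ^ toℕ j
                   , ≡.subst (HasCard (subSetoid (Kᶠ (inject₁ j))))
                       (≡.trans (K-order _ (≤-trans (≤-reflexive (toℕ-inject₁ j)) (<⇒≤ (toℕ<n j))))
                                (≡.cong (q ^_) (toℕ-inject₁ j)))
                       (order-toSubgroup (K (toℕ (inject₁ j))))
                   , ≡.subst (HasCard (subSetoid (Kᶠ (fsuc j)))) (K-order (suc (toℕ j)) (toℕ<n j))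
                       (order-toSubgroup (K (suc (toℕ j)))) }

  χ-injective : ∀ {a b} → χ a H.≈ χ b → a ≡ b
  χ-injective {a} {b} eq = ≡.trans (≡.sym (τχ a)) (≡.trans (τ-cong eq) (τχ b))

  coordinates : Inverse (Group.setoid G) (Hⁿ H n)
  coordinates = record
    { to        = λ x k → χ (coord (φ x) k)
    ; from      = λ v → ψ (coord⁻¹ (τ ∘ v))
    ; to-cong   = λ x≈y k → H.reflexive (≡.cong (λ z → χ (coord z k)) (φ-cong x≈y))
    ; from-cong = λ {v} {w} v≈w → G.reflexive (≡.cong ψ (coord-injective λ k →
                    ≡.trans (coord-coord⁻¹ _ k) (≡.trans (τ-cong (v≈w k)) (≡.sym (coord-coord⁻¹ _ k)))))
    ; inverse   = (λ {v} x≈ k → H.trans (H.reflexive (≡.cong χ (≡.trans (≡.cong (λ z → coord z k)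
                                   (≡.trans (φ-cong x≈) (φψ _))) (coord-coord⁻¹ _ k)))) (χτ (v k)))
                , (λ {x} v≈ → G.trans (G.reflexive (≡.cong ψ (coord-injective λ k →
                                   ≡.trans (coord-coord⁻¹ _ k) (≡.trans (τ-cong (v≈ k)) (τχ _)))))
                                 (ψφ x)) }

  preserves-distance : ∀ x y d → Chain.DistC chain x y d ⇔
                       DistRT H n (Inverse.to coordinates x) (Inverse.to coordinates y) d
  preserves-distance x y d = mk⇔ into back
    where
    mem⇒~ : ∀ {i} → φ (x G.∙ y G.⁻¹) ∈ K i → φ x ~[ i ] φ y
    mem⇒~ {i} = ∈-resp (K i) (φ-quotient x y)
    ~⇒mem : ∀ {i} → φ x ~[ i ] φ y → φ (x G.∙ y G.⁻¹) ∈ K i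
    ~⇒mem {i} = ∈-resp (K i) (≡.sym (φ-quotient x y))
    ≡⇒≈ : ∀ {k} → coord (φ x) k ≡ coord (φ y) k → χ (coord (φ x) k) H.≈ χ (coord (φ y) k)
    ≡⇒≈ = H.reflexive ∘ ≡.cong χ
    into : Chain.DistC chain x y d → DistRT H n _ _ d
    into (fzero , 0≡d , lift x~y , _) = inj₁ (≡.sym 0≡d , λ k → ≡⇒≈ (~⇒agreeFrom z≤n (mem⇒~ x~y) k z≤n))
    into (fsuc j , 1+j≡d , lift x~y , notBelow) = inj₂ (j , ≡.sym 1+j≡d , differs , λ k j<k → ≡⇒≈ (agree k j<k))
      where
      agree : AgreeFrom (suc (toℕ j)) (φ x) (φ y)
      agree = ~⇒agreeFrom (toℕ<n j) (mem⇒~ x~y)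
      differs : ¬ χ (coord (φ x) j) H.≈ χ (coord (φ y) j)
      differs eq = notBelow (lift (K-inject₁⁻ j (~⇒mem
                     (agreeFrom⇒~ (<⇒≤ (toℕ<n j)) (agreeFrom-suc (toℕ<n j) agree (χ-injective eq))))))
    back : DistRT H n _ _ d → Chain.DistC chain x y d
    back (inj₁ (d≡0 , equal)) = fzero , ≡.sym d≡0 , lift (~⇒mem (agreeFrom⇒~ z≤n λ k _ → χ-injective (equal k))) , _
    back (inj₂ (j , d≡1+j , differs , above)) =
      fsuc j , ≡.sym d≡1+j , lift (~⇒mem (agreeFrom⇒~ (toℕ<n j) λ k j<k → χ-injective (above k j<k))) ,
      λ (lift x~y) → differs (≡⇒≈ (~⇒agreeFrom (<⇒≤ (toℕ<n j)) (mem⇒~ (K-inject₁ j x~y)) j ≤-refl))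

  isometric : Isometric chain H
  isometric = coordinates , preserves-distance

theorem7p11 : ∀ {c₁ ℓ₁ c₂ ℓ₂} (q n : ℕ) → IsPrimePower q →
    (G : Group c₁ ℓ₁) (H : Group c₂ ℓ₂) →
    HasCard (Group.setoid G) (q ^ n) → HasCard (Group.setoid H) q →
    Σ (Chain G n q) λ C → Isometric C H
theorem7p11 q n (p , k , p-prime , 1≤k , ≡.refl) G H |G| |H| = chain , isometric
  where
  open CoarseChain (Transport.finGroup G |G|) {k = k} p-prime ≡.refl n ≡.refl
  open ChainIsometry G H |G| |H| (prime^>1 p-prime 1≤k) coarse coarse-step order-coarse coarse-bottom coarse-top
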